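{- For any integers $n \ge 1$ and $c \ge 3$, \[ \left\lceil\frac{1}{2} \left(n-1-\frac{n-1}{c-1}\right)n\right\rceil \le P^*_c(n) \le \frac{c-2}{2(c-1)}n^2+n. \]
   Context: There are $n$ balls, each colored with one of $c$ possible colors (not every color needs to occur). A query is a pair of balls, and its answer tells whether the two balls have the same color or not. A ball is a plurality ball if its color class is strictly larger than every other color class. The plurality problem is: determine whether a plurality color exists and, if so, exhibit one ball of that color. In a non-adaptive strategy a set $Q$ of queries is fixed in advance and all answers are then received; $Q$ solves the problem if, for every coloring of the balls with at most $c$ colors, the answers determine the correct output. $P^*_c(n)$ denotes the minimum number of queries in a non-adaptive strategy solving the plurality problem. -}

module Defs where

open import Data.Nat using (ℕ; _<_)
open import Data.Fin using (Fin; _≟_)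
open import Data.Bool using (Bool)
open import Data.List using (List; length; filter; map; allFin)
open import Data.Maybe using (Maybe; just; nothing)
open import Data.Product using (_×_; _,_; ∃)
open import Relation.Nullary using (¬_; does)
open import Relation.Binary.PropositionalEquality using (_≡_)

Coloring : ℕ → ℕ → Set
Coloring n c = Fin n → Fin c

classSize : ∀ {n c} → Coloring n c → Fin c → ℕ
classSize {n} χ k = length (filter (λ i → χ i ≟ k) (allFin n))

PluralityBall : ∀ {n c} → Coloring n c → Fin n → Set
PluralityBall χ b = ∀ k → ¬ (k ≡ χ b) → classSize χ k < classSize χ (χ b)

Query : ℕ → Set
Query n = Fin n × Fin n

answer : ∀ {n c} → Coloring n c → Query n → Bool
answer χ (i , j) = does (χ i ≟ χ j)

answers : ∀ {n c} → Coloring n c → List (Query n) → List Bool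
answers χ Q = map (answer χ) Q

CorrectOutput : ∀ {n c} → Coloring n c → Maybe (Fin n) → Set
CorrectOutput χ nothing  = ¬ (∃ λ b → PluralityBall χ b)
CorrectOutput χ (just b) = PluralityBall χ b

-- The non-adaptive query set Q solves the plurality problem for c colors:
-- the answers determine a correct output for every coloring.
Solves : (n c : ℕ) → List (Query n) → Set
Solves n c Q = ∃ λ (f : List Bool → Maybe (Fin n)) →
  ∀ (χ : Coloring n c) → CorrectOutput χ (f (answers χ Q))

-- Fix a ball v and let m be the number of balls never compared with v.  If
-- (c - 1) m > n - 1, color some of these strangers with a color A, spread all other balls as
-- evenly as possible over c - 2 further colors, and give v either the color A or an unused
-- color Z.  No neighbor of v has either color, so the two colorings answer every query
-- alike, yet the class sizes can be chosen so that exactly one of them has a plurality ball.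
-- Hence every ball is compared with at least (n - 1)(c - 2)/(c - 1) others.
--
-- Split the balls by residue mod p = c - 1 into p parts of nearly equal size,
-- let the first ball of each part be its center, and query every pair except two non-centers
-- of the same part.  A color class containing a center or meeting two parts is determined by
-- the answers; any other class lies among the non-centers of a single part.  If one part held
-- two such hidden classes, counting the p + 1 colors against the p parts would yield a
-- determined class larger than the non-centers of that part.  Hence colorings with the same
-- answers have the same plurality balls, and a decoder may use any consistent coloring.  The
-- omitted pairs are counted with the floor sum Σ_{y<n} ⌊y/p⌋ ≥ (n² - p n)/(2p).

module Submission where

open import Defs
open import Data.Nat using (ℕ; _≤_; _*_; _+_; _∸_)
open import Data.List using (List; length)
open import Data.Product using (_×_; ∃)

open import Level using (Level; 0ℓ)
open import Data.Bool using (Bool; if_then_else_) renaming (_≟_ to _≟ᵇ_)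
open import Data.Nat using (zero; suc; _<_; z≤n; s≤s; _<?_; _≤?_; NonZero; >-nonZero⁻¹; _%_; _/_)
open import Data.Nat.Properties hiding (_≟_)
open import Data.Nat.DivMod
  using (_mod_; m%n<n; m%n≤m; m%n≤n; m%n%n≡m%n; m<n⇒m%n≡m; [m+n]%n≡m%n; m≡m%n+[m/n]*n; +-distrib-/-∣ˡ; m*n/n≡m; m<n⇒m/n≡0; m/n*n≤m)
open import Data.Nat.Divisibility using (divides-refl)
open import Data.Nat.Tactic.RingSolver using (solve)
open import Data.Fin using (Fin; zero; suc; toℕ; fromℕ<; _≟_)
open import Data.Fin.Properties as Finₚ using (any?; all?; ¬∀⟶∃¬; toℕ-fromℕ<; toℕ-injective; toℕ<n)
open import Data.List using ([]; _∷_; filter; tabulate; allFin; map; concatMap)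
open import Data.List.Properties using (≡-dec; map-cong; map-cong-local; length-map; length-++; ∷-injective)
open import Data.List.Membership.Propositional using (_∈_; lose)
open import Data.List.Membership.Propositional.Properties using (∈-concatMap⁺; ∈-map⁺; ∈-filter⁺; ∈-allFin)
open import Data.List.Relation.Unary.Any as Any using (Any; here; there)
import Data.List.Relation.Unary.All as All
open import Data.Maybe using (Maybe; just; nothing)
open import Data.Product using (_,_; proj₁; proj₂)
open import Data.Sum using (_⊎_; inj₁; inj₂; map₂)
open import Data.Empty using (⊥; ⊥-elim)
import Data.Vec.Functional as Vector
open import Relation.Nullary using (Dec; yes; no; does; ¬_; contradiction)
open import Relation.Nullary.Decidable using (¬?; _×-dec_; _⊎-dec_; _→-dec_; decidable-stable)
open import Relation.Unary using (Pred; Decidable)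
open import Relation.Binary using (tri<; tri≈; tri>)
open import Relation.Binary.PropositionalEquality
open import Algebra.Properties.Semiring.Sum +-*-semiring
  using (sum; sum-syntax; sum-cong-≗; ∑-distrib-+; ∑-comm; *-distribˡ-sum; *-distribʳ-sum)

private variable
  ℓ ℓ₁ ℓ₂ : Level
  X : Set ℓ₁
  Y : Set ℓ₂
  n c : ℕ


-- Indicators and finite sums

𝟙 : Dec X → ℕ
𝟙 d = if does d then 1 else 0

𝟙-yes : (d : Dec X) → X → 𝟙 d ≡ 1
𝟙-yes (yes _) _ = refl
𝟙-yes (no ¬x) x = contradiction x ¬x

𝟙-no : (d : Dec X) → ¬ X → 𝟙 d ≡ 0
𝟙-no (yes x) ¬x = contradiction x ¬x
𝟙-no (no _) _ = refl

𝟙≤1 : (d : Dec X) → 𝟙 d ≤ 1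
𝟙≤1 (yes _) = ≤-refl
𝟙≤1 (no _) = z≤n

𝟙-mono : (d : Dec X) (e : Dec Y) → (X → Y) → 𝟙 d ≤ 𝟙 e
𝟙-mono (yes x) e f = ≤-reflexive (sym (𝟙-yes e (f x)))
𝟙-mono (no _) e f = z≤n

𝟙-cong : (d : Dec X) (e : Dec Y) → (X → Y) → (Y → X) → 𝟙 d ≡ 𝟙 e
𝟙-cong d e f g = ≤-antisym (𝟙-mono d e f) (𝟙-mono e d g)

𝟙-× : (d : Dec X) (e : Dec Y) → 𝟙 (d ×-dec e) ≡ 𝟙 d * 𝟙 e
𝟙-× (yes _) (yes _) = refl
𝟙-× (yes _) (no _) = refl
𝟙-× (no _) _ = refl

𝟙-split : (d : Dec X) (e : Dec Y) → 𝟙 (d ×-dec e) + 𝟙 (d ×-dec ¬? e) ≡ 𝟙 d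
𝟙-split (yes _) (yes _) = refl
𝟙-split (yes _) (no _) = refl
𝟙-split (no _) _ = refl

𝟙*𝟙≤𝟙ˡ : (d : Dec X) (e : Dec Y) → 𝟙 d * 𝟙 e ≤ 𝟙 d
𝟙*𝟙≤𝟙ˡ d e = ≤-trans (≤-reflexive (sym (𝟙-× d e))) (𝟙-mono (d ×-dec e) d proj₁)

𝟙-⊎ : (d : Dec X) (e : Dec Y) → 𝟙 (d ⊎-dec e) ≤ 𝟙 d + 𝟙 e
𝟙-⊎ (yes _) _ = s≤s z≤n
𝟙-⊎ (no _) e = ≤-refl

does-cong : (d : Dec X) (e : Dec Y) → (X → Y) → (Y → X) → does d ≡ does e
does-cong (yes _) (yes _) _ _ = refl
does-cong (yes x) (no ¬y) f _ = contradiction (f x) ¬y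
does-cong (no ¬x) (yes y) _ g = contradiction (g y) ¬x
does-cong (no _) (no _) _ _ = refl

∑-mono-≤ : {f g : Fin n → ℕ} → (∀ i → f i ≤ g i) → sum f ≤ sum g
∑-mono-≤ {zero} _ = z≤n
∑-mono-≤ {suc n} f≤g = +-mono-≤ (f≤g zero) (∑-mono-≤ (λ i → f≤g (suc i)))

∑-const : ∀ n k → ∑[ i < n ] k ≡ n * k
∑-const zero k = refl
∑-const (suc n) k = cong (k +_) (∑-const n k)

∑-zero : {f : Fin n → ℕ} → (∀ i → f i ≡ 0) → sum f ≡ 0
∑-zero {n} f≡0 = trans (sum-cong-≗ f≡0) (trans (∑-const n 0) (*-zeroʳ n))

term≤∑ : (f : Fin n → ℕ) (x : Fin n) → f x ≤ sum f
term≤∑ f zero = m≤m+n _ _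
term≤∑ f (suc x) = ≤-trans (term≤∑ (λ i → f (suc i)) x) (m≤n+m _ _)

∑-δ : (x : Fin n) (f : Fin n → ℕ) → ∑[ i < n ] (𝟙 (x ≟ i) * f i) ≡ f x
∑-δ {suc n} zero f = trans (cong (f zero + 0 +_) (∑-zero {n} (λ _ → refl))) (trans (+-identityʳ _) (+-identityʳ _))
∑-δ (suc x) f = ∑-δ x (λ i → f (suc i))

∑-δ-1 : (x : Fin n) → ∑[ i < n ] 𝟙 (x ≟ i) ≡ 1
∑-δ-1 {n} x = trans (sum-cong-≗ (λ i → sym (*-identityʳ (𝟙 (x ≟ i))))) (∑-δ x (λ _ → 1))

count : {P : Pred (Fin n) ℓ} → Decidable P → ℕ
count {n} P? = ∑[ i < n ] 𝟙 (P? i)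

1≤count : {P : Pred (Fin n) ℓ} (P? : Decidable P) {x : Fin n} → P x → 1 ≤ count P?
1≤count P? {x} px = ≤-trans (≤-reflexive (sym (𝟙-yes (P? x) px))) (term≤∑ (λ i → 𝟙 (P? i)) x)

2≤count : {P : Pred (Fin n) ℓ} (P? : Decidable P) {x y : Fin n} →
          ¬ x ≡ y → P x → P y → 2 ≤ count P?
2≤count {n} P? {x} {y} x≢y px py = begin
  2                                         ≡⟨ cong₂ _+_ (∑-δ-1 x) (∑-δ-1 y) ⟨
  ∑[ i < n ] 𝟙 (x ≟ i) + ∑[ i < n ] 𝟙 (y ≟ i) ≡⟨ ∑-distrib-+ (λ i → 𝟙 (x ≟ i)) (λ i → 𝟙 (y ≟ i)) ⟨
  ∑[ i < n ] (𝟙 (x ≟ i) + 𝟙 (y ≟ i))          ≤⟨ ∑-mono-≤ bound ⟩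
  count P?                                  ∎
  where
  open ≤-Reasoning
  bound : ∀ i → 𝟙 (x ≟ i) + 𝟙 (y ≟ i) ≤ 𝟙 (P? i)
  bound i with x ≟ i | y ≟ i
  ... | yes refl | yes refl = contradiction refl x≢y
  ... | yes refl | no _ = ≤-reflexive (sym (𝟙-yes (P? i) px))
  ... | no _ | yes refl = ≤-reflexive (sym (𝟙-yes (P? i) py))
  ... | no _ | no _ = z≤n

count≤1 : {P : Pred (Fin n) ℓ} (P? : Decidable P) → (∀ {x y} → P x → P y → x ≡ y) → count P? ≤ 1
count≤1 {zero} P? unique = z≤n
count≤1 {suc n} P? unique with P? zero
... | yes p0 = ≤-reflexive (cong suc (∑-zero (λ i → 𝟙-no (P? (suc i)) (λ pi → 0≢suc (unique p0 pi)))))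
  where
  0≢suc : ∀ {i : Fin n} → ¬ zero ≡ suc i
  0≢suc ()
... | no _ = count≤1 (λ i → P? (suc i)) (λ px py → Finₚ.suc-injective (unique px py))

∑-fibres : ∀ {m} (f : Fin n → Fin m) (g : Fin n → ℕ) → ∑[ j < m ] ∑[ x < n ] (𝟙 (f x ≟ j) * g x) ≡ ∑[ x < n ] g x
∑-fibres f g = trans (∑-comm (λ j x → 𝟙 (f x ≟ j) * g x)) (sum-cong-≗ (λ x → ∑-δ (f x) (λ _ → g x)))

count-≟ : (v : Fin n) → count (λ u → u ≟ v) ≡ 1
count-≟ {n} v = trans (sum-cong-≗ (λ u → 𝟙-cong (u ≟ v) (v ≟ u) sym sym)) (∑-δ-1 v)

count-¬+count : {P : Pred (Fin n) ℓ} (P? : Decidable P) → count (λ u → ¬? (P? u)) + count P? ≡ n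
count-¬+count {n} P? = begin
  count (λ u → ¬? (P? u)) + count P?     ≡⟨ ∑-distrib-+ (λ u → 𝟙 (¬? (P? u))) (λ u → 𝟙 (P? u)) ⟨
  ∑[ u < n ] (𝟙 (¬? (P? u)) + 𝟙 (P? u))  ≡⟨ sum-cong-≗ (λ u → complement (P? u)) ⟩
  ∑[ u < n ] 1                           ≡⟨ trans (∑-const n 1) (*-identityʳ n) ⟩
  n                                      ∎
  where
  open ≡-Reasoning
  complement : (d : Dec X) → 𝟙 (¬? d) + 𝟙 d ≡ 1
  complement (yes _) = refl
  complement (no _) = refl

count-≢ : ∀ {L} (v : Fin (suc L)) → count (λ u → ¬? (u ≟ v)) ≡ L
count-≢ {L} v = +-cancelʳ-≡ 1 _ _ (begin
  count (λ u → ¬? (u ≟ v)) + 1                         ≡⟨ cong (count (λ u → ¬? (u ≟ v)) +_) (count-≟ v) ⟨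
  count (λ u → ¬? (u ≟ v)) + count (λ u → u ≟ v)       ≡⟨ count-¬+count (λ u → u ≟ v) ⟩
  suc L                                                ≡⟨ +-comm 1 L ⟩
  L + 1                                                ∎)
  where open ≡-Reasoning

rank : {P : Pred (Fin n) ℓ} → Decidable P → Fin n → ℕ
rank P? zero = 0
rank P? (suc u) = 𝟙 (P? zero) + rank (λ i → P? (suc i)) u

∑-rank : {P : Pred (Fin n) ℓ} (P? : Decidable P) (G : ℕ → ℕ) →
         ∑[ u < n ] (𝟙 (P? u) * G (rank P? u)) ≡ ∑[ t < count P? ] G (toℕ t)
∑-rank {zero} P? G = refl
∑-rank {suc n} P? G with P? zero
... | yes _ = cong₂ _+_ (+-identityʳ (G 0)) (∑-rank (λ i → P? (suc i)) (λ t → G (suc t)))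
... | no _ = ∑-rank (λ i → P? (suc i)) G

∑-range-+ : ∀ a b (G : ℕ → ℕ) →
            ∑[ t < a + b ] G (toℕ t) ≡ ∑[ t < a ] G (toℕ t) + ∑[ t < b ] G (a + toℕ t)
∑-range-+ zero b G = refl
∑-range-+ (suc a) b G =
  trans (cong (G 0 +_) (∑-range-+ a b (λ t → G (suc t)))) (sym (+-assoc (G 0) _ _))

∑-below : ∀ {m} (G : ℕ → ℕ) → m ≤ n → ∑[ t < n ] (𝟙 (toℕ t <? m) * G (toℕ t)) ≡ ∑[ t < m ] G (toℕ t)
∑-below {n} {m} G m≤n = begin
  ∑[ t < n ] H (toℕ t)                              ≡⟨ cong (λ k → ∑[ t < k ] H (toℕ t)) (m+[n∸m]≡n m≤n) ⟨
  ∑[ t < m + (n ∸ m) ] H (toℕ t)                    ≡⟨ ∑-range-+ m (n ∸ m) H ⟩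
  ∑[ t < m ] H (toℕ t) + ∑[ t < n ∸ m ] H (m + toℕ t) ≡⟨ cong₂ _+_ (sum-cong-≗ below) (∑-zero above) ⟩
  ∑[ t < m ] G (toℕ t) + 0                          ≡⟨ +-identityʳ _ ⟩
  ∑[ t < m ] G (toℕ t)                              ∎
  where
  open ≡-Reasoning
  H : ℕ → ℕ
  H s = 𝟙 (s <? m) * G s
  below : ∀ (t : Fin m) → H (toℕ t) ≡ G (toℕ t)
  below t = trans (cong (_* G (toℕ t)) (𝟙-yes (toℕ t <? m) (toℕ<n t))) (+-identityʳ _)
  above : ∀ (t : Fin (n ∸ m)) → H (m + toℕ t) ≡ 0
  above t = cong (_* G (m + toℕ t)) (𝟙-no (m + toℕ t <? m) (m+n≮m m (toℕ t)))

count-below : ∀ {m} → m ≤ n → count (λ (t : Fin n) → toℕ t <? m) ≡ m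
count-below {n} {m} m≤n = begin
  ∑[ t < n ] 𝟙 (toℕ t <? m)             ≡⟨ sum-cong-≗ {n} (λ t → *-identityʳ (𝟙 (toℕ t <? m))) ⟨
  ∑[ t < n ] (𝟙 (toℕ t <? m) * 1)       ≡⟨ ∑-below (λ _ → 1) m≤n ⟩
  ∑[ t < m ] 1                          ≡⟨ trans (∑-const m 1) (*-identityʳ m) ⟩
  m                                     ∎
  where open ≡-Reasoning

triangular : ∀ n → 2 * ∑[ t < n ] suc (toℕ t) ≡ n * suc n
triangular zero = refl
triangular (suc n) = begin
  2 * ∑[ t < suc n ] suc (toℕ t)                   ≡⟨ cong (λ k → 2 * ∑[ t < k ] suc (toℕ t)) (+-comm 1 n) ⟩
  2 * ∑[ t < n + 1 ] suc (toℕ t)                   ≡⟨ cong (2 *_) (∑-range-+ n 1 suc) ⟩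
  2 * (∑[ t < n ] suc (toℕ t) + (suc (n + 0) + 0)) ≡⟨ regroup (∑[ t < n ] suc (toℕ t)) ⟩
  2 * ∑[ t < n ] suc (toℕ t) + 2 * suc n           ≡⟨ cong (_+ 2 * suc n) (triangular n) ⟩
  n * suc n + 2 * suc n                            ≡⟨ solve (n ∷ []) ⟩
  suc n * suc (suc n)                              ∎
  where
  open ≡-Reasoning
  regroup : ∀ S → 2 * (S + (suc (n + 0) + 0)) ≡ 2 * S + 2 * suc n
  regroup S = solve (S ∷ n ∷ [])

-- Residues and floor sums

module _ (p : ℕ) .{{_ : NonZero p}} where

  toℕ-mod : ∀ m → toℕ (m mod p) ≡ m % p
  toℕ-mod m = toℕ-fromℕ< (m%n<n m p)

  mod-toℕ : (j : Fin p) → toℕ j mod p ≡ j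
  mod-toℕ j = toℕ-injective (trans (toℕ-mod (toℕ j)) (m<n⇒m%n≡m (toℕ<n j)))

  mod-+p : ∀ t → (p + t) mod p ≡ t mod p
  mod-+p t = toℕ-injective (begin
    toℕ ((p + t) mod p) ≡⟨ toℕ-mod (p + t) ⟩
    (p + t) % p         ≡⟨ cong (_% p) (+-comm p t) ⟩
    (t + p) % p         ≡⟨ [m+n]%n≡m%n t p ⟩
    t % p               ≡⟨ toℕ-mod t ⟨
    toℕ (t mod p)       ∎)
    where open ≡-Reasoning

  count-mod-below : ∀ {e} (j : Fin p) → e ≤ p → ∑[ t < e ] 𝟙 (toℕ t mod p ≟ j) ≡ 𝟙 (toℕ j <? e)
  count-mod-below {e} j e≤p = begin
    ∑[ t < e ] 𝟙 (toℕ t mod p ≟ j)                     ≡⟨ ∑-below (λ s → 𝟙 (s mod p ≟ j)) e≤p ⟨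
    ∑[ t < p ] (𝟙 (toℕ t <? e) * 𝟙 (toℕ t mod p ≟ j)) ≡⟨ sum-cong-≗ swap ⟩
    ∑[ t < p ] (𝟙 (j ≟ t) * 𝟙 (toℕ t <? e))           ≡⟨ ∑-δ j (λ t → 𝟙 (toℕ t <? e)) ⟩
    𝟙 (toℕ j <? e)                                     ∎
    where
    open ≡-Reasoning
    swap : ∀ t → 𝟙 (toℕ t <? e) * 𝟙 (toℕ t mod p ≟ j) ≡ 𝟙 (j ≟ t) * 𝟙 (toℕ t <? e)
    swap t = trans (*-comm (𝟙 (toℕ t <? e)) _)
      (cong (_* 𝟙 (toℕ t <? e)) (𝟙-cong (toℕ t mod p ≟ j) (j ≟ t)
        (λ eq → trans (sym eq) (mod-toℕ t)) (λ eq → trans (mod-toℕ t) (sym eq))))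

  count-mod : ∀ q {e} (j : Fin p) → e ≤ p → ∑[ t < q * p + e ] 𝟙 (toℕ t mod p ≟ j) ≡ q + 𝟙 (toℕ j <? e)
  count-mod zero j e≤p = count-mod-below j e≤p
  count-mod (suc q) {e} j e≤p = begin
    ∑[ t < suc q * p + e ] 𝟙 (toℕ t mod p ≟ j)                           ≡⟨ cong (λ k → ∑[ t < k ] 𝟙 (toℕ t mod p ≟ j)) (+-assoc p (q * p) e) ⟩
    ∑[ t < p + (q * p + e) ] 𝟙 (toℕ t mod p ≟ j)                         ≡⟨ ∑-range-+ p (q * p + e) (λ s → 𝟙 (s mod p ≟ j)) ⟩
    ∑[ t < p ] 𝟙 (toℕ t mod p ≟ j) + ∑[ t < q * p + e ] 𝟙 ((p + toℕ t) mod p ≟ j)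
      ≡⟨ cong₂ _+_ (trans (count-mod-below j ≤-refl) (𝟙-yes (toℕ j <? p) (toℕ<n j)))
                   (trans (sum-cong-≗ {q * p + e} (λ t → cong (λ r → 𝟙 (r ≟ j)) (mod-+p (toℕ t)))) (count-mod q j e≤p)) ⟩
    suc q + 𝟙 (toℕ j <? e)                                               ∎
    where open ≡-Reasoning

  count-mod′ : ∀ m (j : Fin p) → ∑[ t < m ] 𝟙 (toℕ t mod p ≟ j) ≡ m / p + 𝟙 (toℕ j <? m % p)
  count-mod′ m j = trans (cong (λ k → ∑[ t < k ] 𝟙 (toℕ t mod p ≟ j)) (trans (m≡m%n+[m/n]*n m p) (+-comm (m % p) _)))
                         (count-mod (m / p) j (m%n≤n m p))

  /-quotient : ∀ q {t} → t < p → (q * p + t) / p ≡ q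
  /-quotient q {t} t<p = begin
    (q * p + t) / p     ≡⟨ +-distrib-/-∣ˡ t (divides-refl q) ⟩
    q * p / p + t / p   ≡⟨ cong₂ _+_ (m*n/n≡m q p) (m<n⇒m/n≡0 t<p) ⟩
    q + 0               ≡⟨ +-identityʳ q ⟩
    q                   ∎
    where open ≡-Reasoning

  floorSum : ℕ → ℕ
  floorSum n = ∑[ t < n ] (toℕ t / p)

  floorSum-+ : ∀ q {e} → e ≤ p → floorSum (q * p + e) ≡ floorSum (q * p) + e * q
  floorSum-+ q {e} e≤p = begin
    floorSum (q * p + e)                           ≡⟨ ∑-range-+ (q * p) e (_/ p) ⟩
    floorSum (q * p) + ∑[ t < e ] ((q * p + toℕ t) / p) ≡⟨ cong (floorSum (q * p) +_) (sum-cong-≗ (λ t → /-quotient q (<-≤-trans (toℕ<n t) e≤p))) ⟩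
    floorSum (q * p) + ∑[ t < e ] q                ≡⟨ cong (floorSum (q * p) +_) (∑-const e q) ⟩
    floorSum (q * p) + e * q                       ∎
    where open ≡-Reasoning

  floorSum-* : ∀ q → 2 * floorSum (q * p) + p * q ≡ p * q * q
  floorSum-* zero = trans (*-zeroʳ p) (sym (*-zeroʳ (p * 0)))
  floorSum-* (suc q) = begin
    2 * floorSum (p + q * p) + p * suc q      ≡⟨ cong (λ k → 2 * floorSum k + p * suc q) (+-comm p (q * p)) ⟩
    2 * floorSum (q * p + p) + p * suc q      ≡⟨ cong (λ s → 2 * s + p * suc q) (floorSum-+ q ≤-refl) ⟩
    2 * (floorSum (q * p) + p * q) + p * suc q ≡⟨ regroup (floorSum (q * p)) ⟩
    (2 * floorSum (q * p) + p * q) + (2 * p * q + p) ≡⟨ cong (_+ (2 * p * q + p)) (floorSum-* q) ⟩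
    p * q * q + (2 * p * q + p)               ≡⟨ solve (p ∷ q ∷ []) ⟩
    p * suc q * suc q                         ∎
    where
    open ≡-Reasoning
    regroup : ∀ S → 2 * (S + p * q) + p * suc q ≡ (2 * S + p * q) + (2 * p * q + p)
    regroup S = solve (S ∷ p ∷ q ∷ [])

  square≤floorSum-divMod : ∀ q {e} → e ≤ p → let n = q * p + e in n * n ≤ p * n + 2 * p * floorSum n
  square≤floorSum-divMod q {e} e≤p = +-cancelʳ-≤ (p * p * q + e * e) _ _ (begin
    (q * p + e) * (q * p + e) + (p * p * q + e * e)       ≤⟨ +-monoʳ-≤ ((q * p + e) * (q * p + e)) (+-monoʳ-≤ (p * p * q) (*-monoʳ-≤ e e≤p)) ⟩
    (q * p + e) * (q * p + e) + (p * p * q + e * p)       ≡⟨ solve (p ∷ q ∷ e ∷ []) ⟩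
    p * (q * p + e) + p * (p * q * q) + 2 * p * e * q + e * e ≡⟨ cong (λ s → p * (q * p + e) + p * s + 2 * p * e * q + e * e) (floorSum-* q) ⟨
    p * (q * p + e) + p * (2 * F + p * q) + 2 * p * e * q + e * e ≡⟨ regroup F ⟩
    p * (q * p + e) + 2 * p * (F + e * q) + (p * p * q + e * e) ≡⟨ cong (λ s → p * (q * p + e) + 2 * p * s + (p * p * q + e * e)) (floorSum-+ q e≤p) ⟨
    p * (q * p + e) + 2 * p * floorSum (q * p + e) + (p * p * q + e * e) ∎)
    where
    open ≤-Reasoning
    F : ℕ
    F = floorSum (q * p)
    regroup : ∀ S → p * (q * p + e) + p * (2 * S + p * q) + 2 * p * e * q + e * e
                  ≡ p * (q * p + e) + 2 * p * (S + e * q) + (p * p * q + e * e)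
    regroup S = solve (S ∷ p ∷ q ∷ e ∷ [])

  square≤floorSum : ∀ n → n * n ≤ p * n + 2 * p * floorSum n
  square≤floorSum n = subst (λ m → m * m ≤ p * m + 2 * p * floorSum m) (sym n≡qp+e) (square≤floorSum-divMod (n / p) (m%n≤n n p))
    where
    n≡qp+e : n ≡ n / p * p + n % p
    n≡qp+e = trans (m≡m%n+[m/n]*n n p) (+-comm (n % p) _)

-- Plurality balls and decoding

length-concatMap-tabulate : ∀ {n} (f : Fin n → X) (g : X → List Y) →
                            length (concatMap g (tabulate f)) ≡ ∑[ i < n ] length (g (f i))
length-concatMap-tabulate {n = zero} f g = refl
length-concatMap-tabulate {n = suc n} f g =
  trans (length-++ (g (f zero))) (cong (length (g (f zero)) +_) (length-concatMap-tabulate (λ i → f (suc i)) g))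

map-≡⇒∈ : ∀ {f g : X → Y} {xs} → map f xs ≡ map g xs → ∀ {x} → x ∈ xs → f x ≡ g x
map-≡⇒∈ {xs = _ ∷ _} eq (here refl) = proj₁ (∷-injective eq)
map-≡⇒∈ {xs = _ ∷ _} eq (there x∈xs) = map-≡⇒∈ (proj₂ (∷-injective eq)) x∈xs

does-≡⇒ : (d : Dec X) (e : Dec Y) → does d ≡ does e → X → Y
does-≡⇒ (yes _) (yes b) _ _ = b
does-≡⇒ (no ¬a) _ _ a = contradiction a ¬a
does-≡⇒ (yes _) (no _) () _

length-filter-tabulate : {P : Pred X ℓ} (P? : Decidable P) (f : Fin n → X) →
                         length (filter P? (tabulate f)) ≡ ∑[ i < n ] 𝟙 (P? (f i))
length-filter-tabulate {n = zero} P? f = refl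
length-filter-tabulate {n = suc n} P? f with P? (f zero)
... | yes _ = cong suc (length-filter-tabulate P? (λ i → f (suc i)))
... | no _ = length-filter-tabulate P? (λ i → f (suc i))

classSize≡count : (χ : Coloring n c) (k : Fin c) → classSize χ k ≡ count (λ i → χ i ≟ k)
classSize≡count χ k = length-filter-tabulate (λ i → χ i ≟ k) (λ i → i)

PluralityBall? : (χ : Coloring n c) → Decidable (PluralityBall χ)
PluralityBall? χ b = all? (λ k → ¬? (k ≟ χ b) →-dec (classSize χ k <? classSize χ (χ b)))

plurality-of-color : (χ : Coloring n c) {k : Fin c} {b : Fin n} → χ b ≡ k →
                     (∀ k′ → ¬ k′ ≡ k → classSize χ k′ < classSize χ k) → PluralityBall χ b
plurality-of-color χ refl largest = largest

tie⇒no-plurality : (χ : Coloring n c) {k₁ k₂ : Fin c} → ¬ k₁ ≡ k₂ → classSize χ k₁ ≤ classSize χ k₂ →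
                   (∀ k → classSize χ k ≤ classSize χ k₁) → ∀ b → ¬ PluralityBall χ b
tie⇒no-plurality χ {k₁} {k₂} k₁≢k₂ k₁≤k₂ maximal b plural with χ b ≟ k₁
... | yes refl = <-irrefl refl (≤-trans (plural k₂ (λ eq → k₁≢k₂ (sym eq))) k₁≤k₂)
... | no χb≢k₁ = <-irrefl refl (≤-trans (plural k₁ (λ eq → χb≢k₁ (sym eq))) (maximal (χ b)))

empty-class : (χ : Coloring n c) {k : Fin c} → (∀ b → ¬ χ b ≡ k) → classSize χ k ≡ 0
empty-class χ {k} unused = trans (classSize≡count χ k) (∑-zero (λ b → 𝟙-no (χ b ≟ k) (unused b)))

own-class-nonempty : (χ : Coloring n c) (b : Fin n) → 1 ≤ classSize χ (χ b)
own-class-nonempty χ b = subst (1 ≤_) (sym (classSize≡count χ (χ b))) (1≤count (λ i → χ i ≟ χ b) refl)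

nonempty-class : (χ : Coloring n c) (k : Fin c) → 1 ≤ classSize χ k → ∃ λ b → χ b ≡ k
nonempty-class χ k 1≤size with any? (λ b → χ b ≟ k)
... | yes found = found
... | no none = contradiction (subst (1 ≤_) (empty-class χ (λ b eq → none (b , eq))) 1≤size) λ ()

Solves-∃plurality : {Q : List (Query n)} → Solves n c Q → {χ₁ χ₂ : Coloring n c} →
                    answers χ₁ Q ≡ answers χ₂ Q → ∃ (PluralityBall χ₁) → ∃ (PluralityBall χ₂)
Solves-∃plurality {Q = Q} (decode , correct) {χ₁} {χ₂} same plural₁ =
  output-∃ (decode (answers χ₂ Q)) (subst (λ ans → CorrectOutput χ₁ (decode ans)) same (correct χ₁)) (correct χ₂)
  where
  output-∃ : ∀ o → CorrectOutput χ₁ o → CorrectOutput χ₂ o → ∃ (PluralityBall χ₂)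
  output-∃ nothing none₁ _ = contradiction plural₁ none₁
  output-∃ (just b) _ plural₂ = b , plural₂

any-function? : (P : (Fin n → Fin c) → Set) → (∀ χ → Dec (P χ)) →
                (∀ {χ χ′} → (∀ i → χ i ≡ χ′ i) → P χ → P χ′) → Dec (∃ P)
any-function? {zero} P P? resp with P? (λ ())
... | yes p = yes (_ , p)
... | no ¬p = no λ (χ , pχ) → ¬p (resp (λ ()) pχ)
any-function? {suc n} P P? resp
  with any? (λ k → any-function? (λ χ → P (k Vector.∷ χ)) (λ χ → P? (k Vector.∷ χ))
                                 (λ eq → resp (λ { zero → refl ; (suc i) → eq i })))
... | yes (k , χ , p) = yes (_ , p)
... | no ¬p = no λ (χ , pχ) → ¬p (χ zero , (λ i → χ (suc i)) , resp (λ { zero → refl ; (suc i) → refl }) pχ)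

answers-cong : {χ χ′ : Coloring n c} → (∀ i → χ i ≡ χ′ i) → (Q : List (Query n)) → answers χ Q ≡ answers χ′ Q
answers-cong eq = map-cong (λ (x , y) → cong₂ (λ a b → does (a ≟ b)) (eq x) (eq y))

answers-determine-plurality⇒Solves : (Q : List (Query n)) →
  (∀ {χ χ′ : Coloring n c} → answers χ Q ≡ answers χ′ Q → ∀ b → PluralityBall χ b → PluralityBall χ′ b) →
  Solves n c Q
answers-determine-plurality⇒Solves {n} {c} Q transfer = decode , correct
  where
  consistent? : ∀ ans → Dec (∃ λ (χ : Coloring n c) → answers χ Q ≡ ans)
  consistent? ans = any-function? _ (λ χ → ≡-dec _≟ᵇ_ (answers χ Q) ans) (λ eq e → trans (sym (answers-cong eq Q)) e)

  report : {χ : Coloring n c} → Dec (∃ (PluralityBall χ)) → Maybe (Fin n)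
  report (yes (b , _)) = just b
  report (no _) = nothing

  decodeWith : ∀ {ans} → Dec (∃ λ (χ : Coloring n c) → answers χ Q ≡ ans) → Maybe (Fin n)
  decodeWith (yes (χ , _)) = report (any? (PluralityBall? χ))
  decodeWith (no _) = nothing

  decode : List Bool → Maybe (Fin n)
  decode ans = decodeWith (consistent? ans)

  report-correct : {χ χ′ : Coloring n c} → answers χ′ Q ≡ answers χ Q →
                   (d : Dec (∃ (PluralityBall χ′))) → CorrectOutput χ (report d)
  report-correct same (yes (b , plural)) = transfer same b plural
  report-correct same (no none) (b , plural) = none (b , transfer (sym same) b plural)

  correct-with : (χ : Coloring n c) (d : Dec (∃ λ χ′ → answers χ′ Q ≡ answers χ Q)) → CorrectOutput χ (decodeWith d)
  correct-with χ (yes (χ′ , same)) = report-correct same (any? (PluralityBall? χ′))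
  correct-with χ (no inconsistent) = contradiction (χ , refl) inconsistent

  correct : ∀ χ → CorrectOutput χ (decode (answers χ Q))
  correct χ = correct-with χ (consistent? (answers χ Q))

-- Lower bound

Joins : Fin n → Fin n → Query n → Set
Joins v u (x , y) = (x ≡ v × y ≡ u) ⊎ (x ≡ u × y ≡ v)

joins? : (v u : Fin n) → Decidable (Joins v u)
joins? v u (x , y) = ((x ≟ v) ×-dec (y ≟ u)) ⊎-dec ((x ≟ u) ×-dec (y ≟ v))

Neighbor : List (Query n) → Fin n → Fin n → Set
Neighbor Q v u = Any (Joins v u) Q

neighbor? : (Q : List (Query n)) (v : Fin n) → Decidable (Neighbor Q v)
neighbor? Q v u = Any.any? (joins? v u) Q

count-joins : ((x , y) : Query n) (v : Fin n) → count (λ u → joins? v u (x , y)) ≤ 𝟙 (x ≟ v) + 𝟙 (y ≟ v)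
count-joins {n} (x , y) v = begin
  count (λ u → joins? v u (x , y))                                       ≤⟨ ∑-mono-≤ bound ⟩
  ∑[ u < n ] (𝟙 (y ≟ u) * 𝟙 (x ≟ v) + 𝟙 (x ≟ u) * 𝟙 (y ≟ v))             ≡⟨ ∑-distrib-+ (λ u → 𝟙 (y ≟ u) * 𝟙 (x ≟ v)) (λ u → 𝟙 (x ≟ u) * 𝟙 (y ≟ v)) ⟩
  ∑[ u < n ] (𝟙 (y ≟ u) * 𝟙 (x ≟ v)) + ∑[ u < n ] (𝟙 (x ≟ u) * 𝟙 (y ≟ v)) ≡⟨ cong₂ _+_ (∑-δ y (λ _ → 𝟙 (x ≟ v))) (∑-δ x (λ _ → 𝟙 (y ≟ v))) ⟩
  𝟙 (x ≟ v) + 𝟙 (y ≟ v)                                                  ∎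
  where
  open ≤-Reasoning
  bound : ∀ u → 𝟙 (joins? v u (x , y)) ≤ 𝟙 (y ≟ u) * 𝟙 (x ≟ v) + 𝟙 (x ≟ u) * 𝟙 (y ≟ v)
  bound u = ≤-trans (𝟙-⊎ ((x ≟ v) ×-dec (y ≟ u)) ((x ≟ u) ×-dec (y ≟ v)))
                    (≤-reflexive (cong₂ _+_ (trans (𝟙-× (x ≟ v) (y ≟ u)) (*-comm (𝟙 (x ≟ v)) (𝟙 (y ≟ u)))) (𝟙-× (x ≟ u) (y ≟ v))))

count-neighbor-∷ : ((x , y) : Query n) (Q : List (Query n)) (v : Fin n) →
                    count (neighbor? ((x , y) ∷ Q) v) ≤ 𝟙 (x ≟ v) + 𝟙 (y ≟ v) + count (neighbor? Q v)
count-neighbor-∷ {n} (x , y) Q v = begin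
  count (neighbor? ((x , y) ∷ Q) v)                          ≤⟨ ∑-mono-≤ (λ u → 𝟙-⊎ (joins? v u (x , y)) (neighbor? Q v u)) ⟩
  ∑[ u < n ] (𝟙 (joins? v u (x , y)) + 𝟙 (neighbor? Q v u))  ≡⟨ ∑-distrib-+ (λ u → 𝟙 (joins? v u (x , y))) (λ u → 𝟙 (neighbor? Q v u)) ⟩
  count (λ u → joins? v u (x , y)) + count (neighbor? Q v)   ≤⟨ +-monoˡ-≤ (count (neighbor? Q v)) (count-joins (x , y) v) ⟩
  𝟙 (x ≟ v) + 𝟙 (y ≟ v) + count (neighbor? Q v)             ∎
  where open ≤-Reasoning

∑-neighbors≤ : (Q : List (Query n)) → ∑[ v < n ] count (neighbor? Q v) ≤ 2 * length Q
∑-neighbors≤ {n} [] = ≤-reflexive (∑-zero {n} (λ v → ∑-zero {n} (λ u → refl)))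
∑-neighbors≤ {n} ((x , y) ∷ Q) = begin
  ∑[ v < n ] count (neighbor? ((x , y) ∷ Q) v)                         ≤⟨ ∑-mono-≤ (count-neighbor-∷ (x , y) Q) ⟩
  ∑[ v < n ] (𝟙 (x ≟ v) + 𝟙 (y ≟ v) + count (neighbor? Q v))           ≡⟨ ∑-distrib-+ (λ v → 𝟙 (x ≟ v) + 𝟙 (y ≟ v)) (λ v → count (neighbor? Q v)) ⟩
  ∑[ v < n ] (𝟙 (x ≟ v) + 𝟙 (y ≟ v)) + ∑[ v < n ] count (neighbor? Q v) ≡⟨ cong (_+ ∑[ v < n ] count (neighbor? Q v)) two-endpoints ⟩
  2 + ∑[ v < n ] count (neighbor? Q v)                                 ≤⟨ +-monoʳ-≤ 2 (∑-neighbors≤ Q) ⟩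
  2 + 2 * length Q                                                     ≡⟨ *-suc 2 (length Q) ⟨
  2 * length ((x , y) ∷ Q)                                             ∎
  where
  open ≤-Reasoning
  two-endpoints : ∑[ v < n ] (𝟙 (x ≟ v) + 𝟙 (y ≟ v)) ≡ 2
  two-endpoints = trans (∑-distrib-+ (λ v → 𝟙 (x ≟ v)) (λ v → 𝟙 (y ≟ v))) (cong₂ _+_ (∑-δ-1 x) (∑-δ-1 y))

recoloring-invisible : (Q : List (Query n)) (v : Fin n) {χ₁ χ₂ : Coloring n c} →
  (∀ u → ¬ u ≡ v → χ₁ u ≡ χ₂ u) →
  (∀ u → ¬ u ≡ v → Neighbor Q v u → ¬ χ₁ u ≡ χ₁ v × ¬ χ₂ u ≡ χ₂ v) →
  answers χ₁ Q ≡ answers χ₂ Q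
recoloring-invisible Q v {χ₁} {χ₂} elsewhere fresh = map-cong-local (All.tabulate same)
  where
  same : ∀ {q} → q ∈ Q → answer χ₁ q ≡ answer χ₂ q
  same {x , y} q∈Q with x ≟ v | y ≟ v
  ... | yes refl | yes refl = does-cong (χ₁ x ≟ χ₁ x) (χ₂ x ≟ χ₂ x) (λ _ → refl) (λ _ → refl)
  ... | yes refl | no y≢v = does-cong (χ₁ x ≟ χ₁ y) (χ₂ x ≟ χ₂ y)
        (λ eq → contradiction (sym eq) (proj₁ (fresh y y≢v (lose q∈Q (inj₁ (refl , refl))))))
        (λ eq → contradiction (sym eq) (proj₂ (fresh y y≢v (lose q∈Q (inj₁ (refl , refl))))))
  ... | no x≢v | yes refl = does-cong (χ₁ x ≟ χ₁ y) (χ₂ x ≟ χ₂ y)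
        (λ eq → contradiction eq (proj₁ (fresh x x≢v (lose q∈Q (inj₂ (refl , refl))))))
        (λ eq → contradiction eq (proj₂ (fresh x x≢v (lose q∈Q (inj₂ (refl , refl))))))
  ... | no x≢v | no y≢v = cong₂ (λ s t → does (s ≟ t)) (elsewhere x x≢v) (elsewhere y y≢v)

module NonNeighbors (k-1 : ℕ) {L : ℕ} (Q : List (Query (suc L))) (v : Fin (suc L)) where

  k : ℕ
  k = suc k-1

  Stranger : Pred (Fin (suc L)) 0ℓ
  Stranger u = ¬ u ≡ v × ¬ Neighbor Q v u

  stranger? : Decidable Stranger
  stranger? u = ¬? (u ≟ v) ×-dec ¬? (neighbor? Q v u)

  degree : ℕ
  degree = count (λ u → ¬? (u ≟ v) ×-dec neighbor? Q v u)

  degree+strangers : degree + count stranger? ≡ L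
  degree+strangers = trans (sym (∑-distrib-+ (λ u → 𝟙 (¬? (u ≟ v) ×-dec neighbor? Q v u)) (λ u → 𝟙 (stranger? u))))
                           (trans (sum-cong-≗ (λ u → 𝟙-split (¬? (u ≟ v)) (neighbor? Q v u))) (count-≢ v))

  strangers : ℕ
  strangers = count stranger?

  degree≤neighbors : degree ≤ count (neighbor? Q v)
  degree≤neighbors = ∑-mono-≤ (λ u → 𝟙-mono (¬? (u ≟ v) ×-dec neighbor? Q v u) (neighbor? Q v u) proj₂)

  -- The colors are A, Z and k further colors B, so c = k + 2.
  Color : Set
  Color = Fin (suc (suc k))

  A Z : Color
  A = zero
  Z = suc zero

  -- Dealing the B colors round-robin makes their classes differ in size by at most one.
  B : ℕ → Color
  B ρ = suc (suc (ρ mod k))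

  B≢A : ∀ ρ → ¬ B ρ ≡ A
  B≢A ρ ()

  B≢Z : ∀ ρ → ¬ B ρ ≡ Z
  B≢Z ρ ()

  module TwoColorings (α : ℕ) where

    Early : Pred (Fin (suc L)) 0ℓ
    Early u = Stranger u × rank stranger? u < α

    early? : Decidable Early
    early? u = stranger? u ×-dec (rank stranger? u <? α)

    late? : ∀ u → Dec (¬ u ≡ v × ¬ Early u)
    late? u = ¬? (u ≟ v) ×-dec ¬? (early? u)

    paint : Color → (u : Fin (suc L)) → Dec (u ≡ v) → Dec (Early u) → Color
    paint t u (yes _) _ = t
    paint t u (no _) (yes _) = A
    paint t u (no _) (no _) = B (rank late? u)

    χ : Color → Coloring (suc L) (suc (suc k))
    χ t u = paint t u (u ≟ v) (early? u)

    χ-v : ∀ t → χ t v ≡ t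
    χ-v t = paint-v (v ≟ v) (early? v)
      where
      paint-v : (d : Dec (v ≡ v)) (f : Dec (Early v)) → paint t v d f ≡ t
      paint-v (yes _) f = refl
      paint-v (no v≢v) f = contradiction refl v≢v

    χ-off : ∀ u → ¬ u ≡ v → χ A u ≡ χ Z u
    χ-off u u≢v = paint-off (u ≟ v) (early? u)
      where
      paint-off : (d : Dec (u ≡ v)) (f : Dec (Early u)) → paint A u d f ≡ paint Z u d f
      paint-off (yes u≡v) f = contradiction u≡v u≢v
      paint-off (no _) (yes _) = refl
      paint-off (no _) (no _) = refl

    χ-late : ∀ t u → ¬ u ≡ v → ¬ Early u → χ t u ≡ B (rank late? u)
    χ-late t u u≢v not-early = paint-late (u ≟ v) (early? u)
      where
      paint-late : (d : Dec (u ≡ v)) (f : Dec (Early u)) → paint t u d f ≡ B (rank late? u)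
      paint-late (yes u≡v) f = contradiction u≡v u≢v
      paint-late (no _) (yes early) = contradiction early not-early
      paint-late (no _) (no _) = refl

    χA≈χZ : answers (χ A) Q ≡ answers (χ Z) Q
    χA≈χZ = recoloring-invisible Q v χ-off λ u u≢v neighbor →
      let late : ∀ t → χ t u ≡ B (rank late? u)
          late t = χ-late t u u≢v (λ (stranger , _) → proj₂ stranger neighbor)
      in (λ eq → B≢A (rank late? u) (trans (sym (late A)) (trans eq (χ-v A))))
       , (λ eq → B≢Z (rank late? u) (trans (sym (late Z)) (trans eq (χ-v Z))))

    private
      pick₁ : ∀ {a b c x y z} → a ≡ 1 → b ≡ 0 → c ≡ 0 → x ≡ a * x + b * y + c * z
      pick₁ {x = x} {y} {z} refl refl refl = solve (x ∷ y ∷ z ∷ [])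
      pick₂ : ∀ {a b c x y z} → a ≡ 0 → b ≡ 1 → c ≡ 0 → y ≡ a * x + b * y + c * z
      pick₂ {x = x} {y} {z} refl refl refl = solve (x ∷ y ∷ z ∷ [])
      pick₃ : ∀ {a b c x y z} → a ≡ 0 → b ≡ 0 → c ≡ 1 → z ≡ a * x + b * y + c * z
      pick₃ {x = x} {y} {z} refl refl refl = solve (x ∷ y ∷ z ∷ [])

    𝟙-paint : ∀ t col u (d : Dec (u ≡ v)) (f : Dec (Early u)) →
              𝟙 (paint t u d f ≟ col) ≡ 𝟙 (v ≟ u) * 𝟙 (t ≟ col) + 𝟙 (early? u) * 𝟙 (A ≟ col) + 𝟙 (late? u) * 𝟙 (B (rank late? u) ≟ col)
    𝟙-paint t col u (yes refl) f =
      pick₁ (𝟙-yes (v ≟ v) refl) (𝟙-no (early? v) (λ ((v≢v , _) , _) → v≢v refl)) (𝟙-no (late? v) (λ (v≢v , _) → v≢v refl))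
    𝟙-paint t col u (no u≢v) (yes early) =
      pick₂ (𝟙-no (v ≟ u) (λ eq → u≢v (sym eq))) (𝟙-yes (early? u) early) (𝟙-no (late? u) (λ (_ , not-early) → not-early early))
    𝟙-paint t col u (no u≢v) (no not-early) =
      pick₃ (𝟙-no (v ≟ u) (λ eq → u≢v (sym eq))) (𝟙-no (early? u) not-early) (𝟙-yes (late? u) (u≢v , not-early))

    count-early : α ≤ strangers → count early? ≡ α
    count-early α≤ = begin
      ∑[ u < suc L ] 𝟙 (early? u)                                  ≡⟨ sum-cong-≗ (λ u → 𝟙-× (stranger? u) (rank stranger? u <? α)) ⟩
      ∑[ u < suc L ] (𝟙 (stranger? u) * 𝟙 (rank stranger? u <? α)) ≡⟨ ∑-rank stranger? (λ r → 𝟙 (r <? α)) ⟩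
      count (λ (t : Fin strangers) → toℕ t <? α)                   ≡⟨ count-below α≤ ⟩
      α                                                            ∎
      where open ≡-Reasoning

    count-late : α ≤ strangers → count late? + α ≡ L
    count-late α≤ = +-cancelʳ-≡ 1 _ _ (begin
      count late? + α + 1                                          ≡⟨ cong₂ (λ a b → count late? + a + b) (count-early α≤) (count-≟ v) ⟨
      count late? + count early? + count (λ u → u ≟ v)             ≡⟨ cong (_+ count (λ u → u ≟ v)) (∑-distrib-+ (λ u → 𝟙 (late? u)) (λ u → 𝟙 (early? u))) ⟨
      ∑[ u < suc L ] (𝟙 (late? u) + 𝟙 (early? u)) + count (λ u → u ≟ v) ≡⟨ ∑-distrib-+ (λ u → 𝟙 (late? u) + 𝟙 (early? u)) (λ u → 𝟙 (u ≟ v)) ⟨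
      ∑[ u < suc L ] (𝟙 (late? u) + 𝟙 (early? u) + 𝟙 (u ≟ v))       ≡⟨ sum-cong-≗ (λ u → partition (u ≟ v) (early? u)) ⟩
      ∑[ u < suc L ] 1                                             ≡⟨ trans (∑-const (suc L) 1) (trans (*-identityʳ (suc L)) (+-comm 1 L)) ⟩
      L + 1                                                        ∎)
      where
      open ≡-Reasoning
      partition : ∀ {u} (d : Dec (u ≡ v)) (f : Dec (Early u)) → 𝟙 (¬? d ×-dec ¬? f) + 𝟙 f + 𝟙 d ≡ 1
      partition (yes u≡v) (yes ((u≢v , _) , _)) = contradiction u≡v u≢v
      partition (yes _) (no _) = refl
      partition (no _) (yes _) = refl
      partition (no _) (no _) = refl

    classSize-χ : α ≤ strangers → ∀ t col →
                  classSize (χ t) col ≡ 𝟙 (t ≟ col) + α * 𝟙 (A ≟ col) + ∑[ ρ < count late? ] 𝟙 (B (toℕ ρ) ≟ col)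
    classSize-χ α≤ t col = begin
      classSize (χ t) col                                              ≡⟨ classSize≡count (χ t) col ⟩
      ∑[ u < suc L ] 𝟙 (χ t u ≟ col)                                   ≡⟨ sum-cong-≗ (λ u → 𝟙-paint t col u (u ≟ v) (early? u)) ⟩
      ∑[ u < suc L ] (𝟙 (v ≟ u) * 𝟙 (t ≟ col) + 𝟙 (early? u) * 𝟙 (A ≟ col) + 𝟙 (late? u) * 𝟙 (B (rank late? u) ≟ col))
        ≡⟨ ∑-distrib-+ (λ u → 𝟙 (v ≟ u) * 𝟙 (t ≟ col) + 𝟙 (early? u) * 𝟙 (A ≟ col)) (λ u → 𝟙 (late? u) * 𝟙 (B (rank late? u) ≟ col)) ⟩
      ∑[ u < suc L ] (𝟙 (v ≟ u) * 𝟙 (t ≟ col) + 𝟙 (early? u) * 𝟙 (A ≟ col)) + ∑[ u < suc L ] (𝟙 (late? u) * 𝟙 (B (rank late? u) ≟ col))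
        ≡⟨ cong₂ _+_ (∑-distrib-+ (λ u → 𝟙 (v ≟ u) * 𝟙 (t ≟ col)) (λ u → 𝟙 (early? u) * 𝟙 (A ≟ col)))
                     (∑-rank late? (λ ρ → 𝟙 (B ρ ≟ col))) ⟩
      ∑[ u < suc L ] (𝟙 (v ≟ u) * 𝟙 (t ≟ col)) + ∑[ u < suc L ] (𝟙 (early? u) * 𝟙 (A ≟ col)) + ∑[ ρ < count late? ] 𝟙 (B (toℕ ρ) ≟ col)
        ≡⟨ cong (_+ ∑[ ρ < count late? ] 𝟙 (B (toℕ ρ) ≟ col))
                (cong₂ _+_ (∑-δ v (λ _ → 𝟙 (t ≟ col))) (trans (sym (*-distribʳ-sum (𝟙 (A ≟ col)) (λ u → 𝟙 (early? u))))
                                                              (cong (_* 𝟙 (A ≟ col)) (count-early α≤)))) ⟩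
      𝟙 (t ≟ col) + α * 𝟙 (A ≟ col) + ∑[ ρ < count late? ] 𝟙 (B (toℕ ρ) ≟ col) ∎
      where open ≡-Reasoning

    module Sizes {q e : ℕ} (α≤ : α ≤ strangers) (late≡ : count late? ≡ q * k + e) (e≤k : e ≤ k) where

      size-A : ∀ t → classSize (χ t) A ≡ 𝟙 (t ≟ A) + α
      size-A t = trans (classSize-χ α≤ t A)
                       (trans (cong₂ (λ s r → 𝟙 (t ≟ A) + s + r) (*-identityʳ α) (∑-zero {count late?} (λ _ → refl))) (+-identityʳ _))

      size-Z : ∀ t → classSize (χ t) Z ≡ 𝟙 (t ≟ Z)
      size-Z t = trans (classSize-χ α≤ t Z)
                       (trans (cong₂ (λ s r → 𝟙 (t ≟ Z) + s + r) (*-zeroʳ α) (∑-zero {count late?} (λ _ → refl)))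
                              (trans (+-identityʳ _) (+-identityʳ _)))

      size-B : ∀ t j → classSize (χ t) (suc (suc j)) ≡ 𝟙 (t ≟ suc (suc j)) + (q + 𝟙 (toℕ j <? e))
      size-B t j = begin
        classSize (χ t) (suc (suc j))                                              ≡⟨ classSize-χ α≤ t (suc (suc j)) ⟩
        𝟙 (t ≟ suc (suc j)) + α * 0 + ∑[ ρ < count late? ] 𝟙 (toℕ ρ mod k ≟ j)     ≡⟨ cong₂ (λ s r → 𝟙 (t ≟ suc (suc j)) + s + r) (*-zeroʳ α)
                                                                                      (cong (λ m → ∑[ ρ < m ] 𝟙 (toℕ ρ mod k ≟ j)) late≡) ⟩
        𝟙 (t ≟ suc (suc j)) + 0 + ∑[ ρ < q * k + e ] 𝟙 (toℕ ρ mod k ≟ j)           ≡⟨ cong₂ _+_ (+-identityʳ _) (count-mod k q j e≤k) ⟩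
        𝟙 (t ≟ suc (suc j)) + (q + 𝟙 (toℕ j <? e))                                 ∎
        where open ≡-Reasoning

      B₀ : Color
      B₀ = suc (suc zero)

      v-wins-in-χA : 1 ≤ α → (∀ j → q + 𝟙 (toℕ j <? e) ≤ α) → (q + 𝟙 (0 <? e) ≡ α ⊎ α ≡ 1) →
                     PluralityBall (χ A) v × (∀ b → ¬ PluralityBall (χ Z) b)
      v-wins-in-χA 1≤α B≤α tie = plurality-of-color (χ A) (χ-v A) below-A , no-winner tie
        where
        below-A : ∀ col → ¬ col ≡ A → classSize (χ A) col < classSize (χ A) A
        below-A zero A≢A = contradiction refl A≢A
        below-A (suc zero) _ = subst₂ _<_ (sym (size-Z A)) (sym (size-A A)) (s≤s z≤n)
        below-A (suc (suc j)) _ = subst₂ _<_ (sym (size-B A j)) (sym (size-A A)) (s≤s (B≤α j))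
        A-maximal : ∀ col → classSize (χ Z) col ≤ classSize (χ Z) A
        A-maximal zero = ≤-refl
        A-maximal (suc zero) = subst₂ _≤_ (sym (size-Z Z)) (sym (size-A Z)) 1≤α
        A-maximal (suc (suc j)) = subst₂ _≤_ (sym (size-B Z j)) (sym (size-A Z)) (B≤α j)
        no-winner : (q + 𝟙 (0 <? e) ≡ α ⊎ α ≡ 1) → ∀ b → ¬ PluralityBall (χ Z) b
        no-winner (inj₁ B₀≡α) = tie⇒no-plurality (χ Z) {A} {B₀} (λ ())
          (subst₂ _≤_ (sym (size-A Z)) (sym (size-B Z zero)) (≤-reflexive (sym B₀≡α))) A-maximal
        no-winner (inj₂ α≡1) = tie⇒no-plurality (χ Z) {A} {Z} (λ ())
          (subst₂ _≤_ (sym (size-A Z)) (sym (size-Z Z)) (≤-reflexive α≡1)) A-maximal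

      B₀-wins-in-χZ : 1 ≤ α → q + 𝟙 (0 <? e) ≡ suc α → (∀ j → ¬ j ≡ zero → q + 𝟙 (toℕ j <? e) ≤ α) →
                      (∀ b → ¬ PluralityBall (χ A) b) × ∃ (PluralityBall (χ Z))
      B₀-wins-in-χZ 1≤α B₀≡1+α B≤α =
        tie⇒no-plurality (χ A) {A} {B₀} (λ ()) (subst₂ _≤_ (sym (size-A A)) (sym (size-B A zero)) (≤-reflexive (sym B₀≡1+α))) A-maximal ,
        (let b , χZb≡B₀ = B₀-class in b , plurality-of-color (χ Z) χZb≡B₀ below-B₀)
        where
        A-maximal : ∀ col → classSize (χ A) col ≤ classSize (χ A) A
        A-maximal zero = ≤-refl
        A-maximal (suc zero) = subst₂ _≤_ (sym (size-Z A)) (sym (size-A A)) z≤n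
        A-maximal (suc (suc zero)) = subst₂ _≤_ (sym (size-B A zero)) (sym (size-A A)) (≤-reflexive B₀≡1+α)
        A-maximal (suc (suc (suc j))) = subst₂ _≤_ (sym (size-B A (suc j))) (sym (size-A A)) (m≤n⇒m≤1+n (B≤α (suc j) (λ ())))
        below-B₀ : ∀ col → ¬ col ≡ B₀ → classSize (χ Z) col < classSize (χ Z) B₀
        below-B₀ zero _ = subst₂ _<_ (sym (size-A Z)) (sym (trans (size-B Z zero) B₀≡1+α)) ≤-refl
        below-B₀ (suc zero) _ = subst₂ _<_ (sym (size-Z Z)) (sym (trans (size-B Z zero) B₀≡1+α)) (s≤s 1≤α)
        below-B₀ (suc (suc zero)) B₀≢B₀ = contradiction refl B₀≢B₀
        below-B₀ (suc (suc (suc j))) _ = subst₂ _<_ (sym (size-B Z (suc j))) (sym (trans (size-B Z zero) B₀≡1+α)) (s≤s (B≤α (suc j) (λ ())))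
        B₀-class : ∃ λ b → χ Z b ≡ B₀
        B₀-class = nonempty-class (χ Z) B₀ (subst (1 ≤_) (sym (trans (size-B Z zero) B₀≡1+α)) (s≤s z≤n))

  strangers≤L : strangers ≤ L
  strangers≤L = subst (strangers ≤_) degree+strangers (m≤n+m strangers degree)

  module _ (solves : Solves (suc L) (suc (suc k)) Q) where
    open TwoColorings

    private
      late≡ : ∀ α q e → α ≤ strangers → L ≡ α + (q * k + e) → count (late? α) ≡ q * k + e
      late≡ α q e α≤ L≡ = +-cancelʳ-≡ α _ _ (trans (count-late α α≤) (trans L≡ (+-comm α _)))

    refute-χA-wins : ∀ α q e → α ≤ strangers → e ≤ k → L ≡ α + (q * k + e) → 1 ≤ α →
                     (∀ j → q + 𝟙 (toℕ j <? e) ≤ α) → (q + 𝟙 (0 <? e) ≡ α ⊎ α ≡ 1) → ⊥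
    refute-χA-wins α q e α≤ e≤k L≡ 1≤α B≤α tie =
      let plural , none = Sizes.v-wins-in-χA α α≤ (late≡ α q e α≤ L≡) e≤k 1≤α B≤α tie
          b , plural′ = Solves-∃plurality solves {χ α A} {χ α Z} (χA≈χZ α) (v , plural)
      in none b plural′

    refute-χZ-wins : ∀ α q e → α ≤ strangers → e ≤ k → L ≡ α + (q * k + e) → 1 ≤ α →
                     q + 𝟙 (0 <? e) ≡ suc α → (∀ j → ¬ j ≡ zero → q + 𝟙 (toℕ j <? e) ≤ α) → ⊥
    refute-χZ-wins α q e α≤ e≤k L≡ 1≤α B₀≡1+α B≤α =
      let none , plural = Sizes.B₀-wins-in-χZ α α≤ (late≡ α q e α≤ L≡) e≤k 1≤α B₀≡1+α B≤α
          b , plural′ = Solves-∃plurality solves {χ α Z} {χ α A} (sym (χA≈χZ α)) plural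
      in none b plural′

    -- Write L = Lq (k + 1) + Lr with Lq < strangers; in each case the choice of α, q, e makes
    -- exactly one of χ A, χ Z have a plurality ball.
    strangers-bound : suc k * strangers ≤ L
    strangers-bound = decidable-stable (suc k * strangers ≤? L) λ ¬bound →
      refute (L / suc k) (L % suc k) (m≡m%n+[m/n]*n L (suc k)) (m%n<n L (suc k)) (quotient<strangers ¬bound)
      where
      quotient<strangers : ¬ suc k * strangers ≤ L → L / suc k < strangers
      quotient<strangers ¬bound = ≰⇒> λ strangers≤q →
        ¬bound (≤-trans (*-monoʳ-≤ (suc k) strangers≤q) (≤-trans (≤-reflexive (*-comm (suc k) (L / suc k))) (m/n*n≤m L (suc k))))

      remainder-0 : ∀ q κ → q * suc κ ≡ q + (q * κ + 0)
      remainder-0 q κ = solve (q ∷ κ ∷ [])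
      remainder-1 : ∀ q κ → 1 + q * suc κ ≡ q + (q * κ + 1)
      remainder-1 q κ = solve (q ∷ κ ∷ [])
      remainder-2+ : ∀ q r κ → 2 + r + q * suc κ ≡ suc q + (q * κ + suc r)
      remainder-2+ q r κ = solve (q ∷ r ∷ κ ∷ [])

      refute : ∀ Lq Lr → L ≡ Lr + Lq * suc k → Lr < suc k → Lq < strangers → ⊥
      refute zero zero L≡0 _ 0<strangers = <-irrefl refl (≤-trans 0<strangers (subst (strangers ≤_) L≡0 strangers≤L))
      refute (suc q) zero L≡ _ q<strangers =
        refute-χA-wins (suc q) (suc q) 0 (<⇒≤ q<strangers) z≤n (trans L≡ (remainder-0 (suc q) k)) (s≤s z≤n)
          (λ j → ≤-reflexive (trans (cong (suc q +_) (𝟙-no (toℕ j <? 0) λ ())) (+-identityʳ (suc q))))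
          (inj₁ (trans (cong (suc q +_) (𝟙-no (0 <? 0) λ ())) (+-identityʳ (suc q))))
      refute zero (suc zero) L≡1 _ 0<strangers =
        refute-χA-wins 1 0 0 0<strangers z≤n L≡1 (s≤s z≤n) (λ j → 𝟙≤1 (toℕ j <? 0)) (inj₂ refl)
      refute (suc q) (suc zero) L≡ _ q<strangers =
        refute-χZ-wins (suc q) (suc q) 1 (<⇒≤ q<strangers) (s≤s z≤n) (trans L≡ (remainder-1 (suc q) k)) (s≤s z≤n)
          (trans (cong (suc q +_) (𝟙-yes (0 <? 1) (s≤s z≤n))) (+-comm (suc q) 1))
          (λ { zero 0≢0 → contradiction refl 0≢0
             ; (suc j) _ → ≤-reflexive (trans (cong (suc q +_) (𝟙-no (suc (toℕ j) <? 1) λ { (s≤s ()) })) (+-identityʳ (suc q))) })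
      refute q (suc (suc r)) L≡ r+2<1+k q<strangers =
        refute-χA-wins (suc q) q (suc r) q<strangers (<⇒≤ (≤-pred r+2<1+k)) (trans L≡ (remainder-2+ q r k)) (s≤s z≤n)
          (λ j → ≤-trans (+-monoʳ-≤ q (𝟙≤1 (toℕ j <? suc r))) (≤-reflexive (+-comm q 1)))
          (inj₁ (trans (cong (q +_) (𝟙-yes (0 <? suc r) (s≤s z≤n))) (+-comm q 1)))

    degree-bound : k * L ≤ suc k * degree
    degree-bound = +-cancelʳ-≤ L (k * L) (suc k * degree) (begin
      k * L + L                                    ≡⟨ +-comm (k * L) L ⟩
      suc k * L                                    ≡⟨ cong (suc k *_) degree+strangers ⟨
      suc k * (degree + strangers)                 ≡⟨ *-distribˡ-+ (suc k) degree strangers ⟩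
      suc k * degree + suc k * strangers           ≤⟨ +-monoʳ-≤ (suc k * degree) strangers-bound ⟩
      suc k * degree + L                           ∎)
      where open ≤-Reasoning

lower-bound : ∀ k-1 {L} (Q : List (Query (suc L))) → Solves (suc L) (suc (suc (suc k-1))) Q →
              L * suc k-1 * suc L ≤ 2 * suc (suc k-1) * length Q
lower-bound k-1 {L} Q solves = begin
  L * k * suc L                                   ≡⟨ trans (*-comm (L * k) (suc L)) (cong (suc L *_) (*-comm L k)) ⟩
  suc L * (k * L)                                 ≡⟨ ∑-const (suc L) (k * L) ⟨
  ∑[ v < suc L ] (k * L)                          ≤⟨ ∑-mono-≤ (λ v → NonNeighbors.degree-bound k-1 Q v solves) ⟩
  ∑[ v < suc L ] (suc k * degree v)               ≡⟨ *-distribˡ-sum (suc k) degree ⟨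
  suc k * ∑[ v < suc L ] degree v                 ≤⟨ *-monoʳ-≤ (suc k) (∑-mono-≤ (λ v → NonNeighbors.degree≤neighbors k-1 Q v)) ⟩
  suc k * ∑[ v < suc L ] count (neighbor? Q v)   ≤⟨ *-monoʳ-≤ (suc k) (∑-neighbors≤ Q) ⟩
  suc k * (2 * length Q)                          ≡⟨ trans (sym (*-assoc (suc k) 2 (length Q))) (cong (_* length Q) (*-comm (suc k) 2)) ⟩
  2 * suc k * length Q                            ∎
  where
  open ≤-Reasoning
  k : ℕ
  k = suc k-1
  degree : Fin (suc L) → ℕ
  degree v = NonNeighbors.degree k-1 Q v

-- Upper bound

module CenteredPartition {n p : ℕ} (part : Fin n → Fin p)
  {IsCenter : Pred (Fin n) 0ℓ} (center? : Decidable IsCenter)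
  (has-center : ∀ x → ∃ λ z → part z ≡ part x × IsCenter z)
  (balanced : ∀ i j → count (λ x → part x ≟ i) ≤ count (λ x → part x ≟ j) + 1) where

  partSize : Fin p → ℕ
  partSize i = count (λ x → part x ≟ i)

  nonCenters : Fin p → ℕ
  nonCenters i = count (λ x → (part x ≟ i) ×-dec ¬? (center? x))

  Compared : Fin n → Fin n → Set
  Compared x y = ¬ part x ≡ part y ⊎ IsCenter x ⊎ IsCenter y

  compared? : ∀ x y → Dec (Compared x y)
  compared? x y = ¬? (part x ≟ part y) ⊎-dec center? x ⊎-dec center? y

  Agree : (χ χ′ : Coloring n (suc p)) → Set
  Agree χ χ′ = ∀ {x y} → Compared x y → χ x ≡ χ y → χ′ x ≡ χ′ y

  Visible : Coloring n (suc p) → Fin n → Set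
  Visible χ x = ∃ λ z → χ z ≡ χ x × (IsCenter z ⊎ ¬ part z ≡ part x)

  visible? : ∀ χ → Decidable (Visible χ)
  visible? χ x = any? (λ z → (χ z ≟ χ x) ×-dec (center? z ⊎-dec ¬? (part z ≟ part x)))

  private variable
    χ χ′ : Coloring n (suc p)
    x y : Fin n

  witness-compared : ∀ {z} → IsCenter z ⊎ ¬ part z ≡ part x → Compared z x
  witness-compared (inj₁ z-center) = inj₂ (inj₁ z-center)
  witness-compared (inj₂ z≁x) = inj₁ z≁x

  visible-agree : Agree χ χ′ → Visible χ x → Visible χ′ x
  visible-agree agree (z , χz≡χx , w) = z , agree (witness-compared w) χz≡χx , w

  visible-closed : Visible χ x → χ x ≡ χ y → Visible χ y
  visible-closed {x = x} {y = y} (z , χz≡χx , w) χx≡χy with part y ≟ part x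
  ... | no y≁x = x , χx≡χy , inj₂ (λ eq → y≁x (sym eq))
  ... | yes y∼x = z , trans χz≡χx χx≡χy , map₂ (λ z≁x z∼y → z≁x (trans z∼y y∼x)) w

  visible-class-agree : Agree χ χ′ → Visible χ x → χ x ≡ χ y → χ′ x ≡ χ′ y
  visible-class-agree {x = x} {y = y} agree (z , χz≡χx , w) χx≡χy with part x ≟ part y
  ... | no x≁y = agree (inj₁ x≁y) χx≡χy
  ... | yes x∼y = trans (sym (agree (witness-compared w) χz≡χx))
                        (agree (witness-compared (map₂ (λ z≁x z∼y → z≁x (trans z∼y (sym x∼y))) w)) (trans χz≡χx χx≡χy))

  hidden-class : ¬ Visible χ y → χ x ≡ χ y → part x ≡ part y × ¬ IsCenter x
  hidden-class {y = y} {x = x} hidden χx≡χy with part x ≟ part y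
  ... | no x≁y = contradiction (x , χx≡χy , inj₂ x≁y) hidden
  ... | yes x∼y = x∼y , λ x-center → hidden (x , χx≡χy , inj₁ x-center)

  classSize-hidden : ¬ Visible χ y → classSize χ (χ y) ≤ nonCenters (part y)
  classSize-hidden {χ = χ} {y = y} hidden = begin
    classSize χ (χ y)     ≡⟨ classSize≡count χ (χ y) ⟩
    count (λ x → χ x ≟ χ y) ≤⟨ ∑-mono-≤ (λ x → 𝟙-mono (χ x ≟ χ y) ((part x ≟ part y) ×-dec ¬? (center? x)) (hidden-class hidden)) ⟩
    nonCenters (part y)   ∎
    where open ≤-Reasoning

  nonCenters<partSize : ∀ {z} → IsCenter z → nonCenters (part z) < partSize (part z)
  nonCenters<partSize {z} z-center = begin
    suc (nonCenters (part z))                                         ≡⟨ +-comm 1 _ ⟩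
    nonCenters (part z) + 1                                           ≡⟨ cong (nonCenters (part z) +_) (∑-δ-1 z) ⟨
    nonCenters (part z) + ∑[ x < n ] 𝟙 (z ≟ x)                         ≡⟨ ∑-distrib-+ (λ x → 𝟙 ((part x ≟ part z) ×-dec ¬? (center? x))) _ ⟨
    ∑[ x < n ] (𝟙 ((part x ≟ part z) ×-dec ¬? (center? x)) + 𝟙 (z ≟ x)) ≤⟨ ∑-mono-≤ bound ⟩
    partSize (part z)                                                 ∎
    where
    open ≤-Reasoning
    bound : ∀ x → 𝟙 ((part x ≟ part z) ×-dec ¬? (center? x)) + 𝟙 (z ≟ x) ≤ 𝟙 (part x ≟ part z)
    bound x with z ≟ x
    ... | yes refl = ≤-reflexive (cong₂ _+_ (𝟙-no ((part z ≟ part z) ×-dec ¬? (center? z)) (λ (_ , non-center) → non-center z-center))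
                                               (sym (𝟙-yes (part z ≟ part z) refl)))
    ... | no _ = ≤-trans (≤-reflexive (+-identityʳ _)) (𝟙-mono ((part x ≟ part z) ×-dec ¬? (center? x)) (part x ≟ part z) proj₁)

  module _ (χ : Coloring n (suc p)) where

    VisibleColor : Fin (suc p) → Set
    VisibleColor k = ∃ λ x → χ x ≡ k × Visible χ x

    visibleColor? : Decidable VisibleColor
    visibleColor? k = any? (λ x → (χ x ≟ k) ×-dec visible? χ x)

    HiddenIn : Fin p → Fin (suc p) → Set
    HiddenIn j k = ∃ λ x → χ x ≡ k × part x ≡ j × ¬ Visible χ x

    hiddenIn? : ∀ j → Decidable (HiddenIn j)
    hiddenIn? j k = any? (λ x → (χ x ≟ k) ×-dec (part x ≟ j) ×-dec ¬? (visible? χ x))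

    visibleIn : Fin p → ℕ
    visibleIn j = count (λ x → (part x ≟ j) ×-dec visible? χ x)

    hiddenColors : Fin p → ℕ
    hiddenColors j = count (hiddenIn? j)

    color-placed-once : ∀ k → 𝟙 (visibleColor? k) + ∑[ j < p ] 𝟙 (hiddenIn? j k) ≤ 1
    color-placed-once k with visibleColor? k
    ... | yes (x , χx≡k , vis) = ≤-reflexive (cong suc (∑-zero (λ j → 𝟙-no (hiddenIn? j k)
            (λ (y , χy≡k , _ , hidden) → hidden (visible-closed vis (trans χx≡k (sym χy≡k)))))))
    ... | no _ = count≤1 (λ j → hiddenIn? j k)
            (λ (y , χy≡k , y∈j , hidden) (y′ , χy′≡k , y′∈j′ , _) →
               trans (sym y∈j) (trans (sym (proj₁ (hidden-class hidden (trans χy′≡k (sym χy≡k))))) y′∈j′))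

    ∑visibleIn≤ : ∀ {a} → (∀ x → Visible χ x → classSize χ (χ x) ≤ a) → ∑[ j < p ] visibleIn j ≤ a * count visibleColor?
    ∑visibleIn≤ {a} small = begin
      ∑[ j < p ] visibleIn j                                      ≡⟨ sum-cong-≗ (λ j → sum-cong-≗ (λ x → 𝟙-× (part x ≟ j) (visible? χ x))) ⟩
      ∑[ j < p ] ∑[ x < n ] (𝟙 (part x ≟ j) * 𝟙 (visible? χ x))   ≡⟨ ∑-fibres part (λ x → 𝟙 (visible? χ x)) ⟩
      ∑[ x < n ] 𝟙 (visible? χ x)                                 ≡⟨ ∑-fibres χ (λ x → 𝟙 (visible? χ x)) ⟨
      ∑[ k < suc p ] ∑[ x < n ] (𝟙 (χ x ≟ k) * 𝟙 (visible? χ x))  ≤⟨ ∑-mono-≤ perColor ⟩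
      ∑[ k < suc p ] (a * 𝟙 (visibleColor? k))                    ≡⟨ *-distribˡ-sum a (λ k → 𝟙 (visibleColor? k)) ⟨
      a * count visibleColor?                                      ∎
      where
      open ≤-Reasoning
      perColor : ∀ k → ∑[ x < n ] (𝟙 (χ x ≟ k) * 𝟙 (visible? χ x)) ≤ a * 𝟙 (visibleColor? k)
      perColor k with visibleColor? k
      ... | yes (x , refl , vis) = begin
        ∑[ y < n ] (𝟙 (χ y ≟ χ x) * 𝟙 (visible? χ y)) ≤⟨ ∑-mono-≤ (λ y → 𝟙*𝟙≤𝟙ˡ (χ y ≟ χ x) (visible? χ y)) ⟩
        count (λ y → χ y ≟ χ x)                      ≡⟨ classSize≡count χ (χ x) ⟨
        classSize χ (χ x)                            ≤⟨ small x vis ⟩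
        a                                            ≡⟨ *-identityʳ a ⟨
        a * 1                                        ∎
      ... | no invisible = ≤-reflexive (trans (∑-zero λ x → trans (sym (𝟙-× (χ x ≟ k) (visible? χ x)))
                                                                  (𝟙-no ((χ x ≟ k) ×-dec visible? χ x) (λ (χx≡k , vis) → invisible (x , χx≡k , vis))))
                                              (sym (*-zeroʳ a)))

    part-lower : ∀ {a} j → a ≤ partSize j → a ≤ a * hiddenColors j + visibleIn j
    part-lower {a} j a≤size with any? (λ x → (part x ≟ j) ×-dec ¬? (visible? χ x))
    ... | yes (x , x∈j , hidden) = ≤-trans (≤-trans (≤-reflexive (sym (*-identityʳ a)))
                                                     (*-monoʳ-≤ a (1≤count (hiddenIn? j) (x , refl , x∈j , hidden))))
                                           (m≤m+n _ _)
    ... | no all-visible = ≤-trans a≤size (≤-trans (≤-reflexive (sum-cong-≗ same)) (m≤n+m _ _))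
      where
      same : ∀ x → 𝟙 (part x ≟ j) ≡ 𝟙 ((part x ≟ j) ×-dec visible? χ x)
      same x = 𝟙-cong (part x ≟ j) ((part x ≟ j) ×-dec visible? χ x)
        (λ x∈j → x∈j , decidable-stable (visible? χ x) (λ hidden → all-visible (x , x∈j , hidden))) proj₁

    split-part-lower : ∀ {a y u} → ¬ Visible χ y → ¬ Visible χ u → part u ≡ part y → ¬ χ y ≡ χ u →
                       a + suc a ≤ a * hiddenColors (part y) + visibleIn (part y)
    split-part-lower {a} {y} {u} y-hidden u-hidden u∼y χy≢χu = begin
      a + suc a                                        ≡⟨ solve (a ∷ []) ⟩
      a * 2 + 1                                        ≤⟨ +-mono-≤ (*-monoʳ-≤ a two-hidden) one-visible ⟩
      a * hiddenColors (part y) + visibleIn (part y)   ∎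
      where
      open ≤-Reasoning
      two-hidden : 2 ≤ hiddenColors (part y)
      two-hidden = 2≤count (hiddenIn? (part y)) χy≢χu (y , refl , refl , y-hidden) (u , refl , u∼y , u-hidden)
      one-visible : 1 ≤ visibleIn (part y)
      one-visible with has-center y
      ... | z , z∼y , z-center = 1≤count (λ x → (part x ≟ part y) ×-dec visible? χ x) (z∼y , z , refl , inj₁ z-center)

    colors-placed : count visibleColor? + ∑[ j < p ] hiddenColors j ≤ suc p
    colors-placed = begin
      count visibleColor? + ∑[ j < p ] ∑[ k < suc p ] 𝟙 (hiddenIn? j k)   ≡⟨ cong (count visibleColor? +_) (∑-comm (λ j k → 𝟙 (hiddenIn? j k))) ⟩
      count visibleColor? + ∑[ k < suc p ] ∑[ j < p ] 𝟙 (hiddenIn? j k)   ≡⟨ ∑-distrib-+ (λ k → 𝟙 (visibleColor? k)) (λ k → ∑[ j < p ] 𝟙 (hiddenIn? j k)) ⟨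
      ∑[ k < suc p ] (𝟙 (visibleColor? k) + ∑[ j < p ] 𝟙 (hiddenIn? j k)) ≤⟨ ∑-mono-≤ color-placed-once ⟩
      ∑[ k < suc p ] 1                                                   ≡⟨ trans (∑-const (suc p) 1) (*-identityʳ (suc p)) ⟩
      suc p                                                              ∎
      where open ≤-Reasoning

    -- Every color is visible or hidden in a single part, so summing part-lower and
    -- split-part-lower over the parts gives p a + a + 1 ≤ a (p + 1).
    hidden-split-impossible : ∀ {a} → (∀ x → Visible χ x → classSize χ (χ x) ≤ a) → (∀ j → a ≤ partSize j) →
                              ∀ {y u} → ¬ Visible χ y → ¬ Visible χ u → part u ≡ part y → ¬ χ y ≡ χ u → ⊥
    hidden-split-impossible {a} small large {y} y-hidden u-hidden u∼y χy≢χu = <-irrefl refl (begin-strict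
      a * suc p                                                          <⟨ n<1+n _ ⟩
      suc (a * suc p)                                                    ≡⟨ total ⟨
      ∑[ j < p ] (a + 𝟙 (part y ≟ j) * suc a)                            ≤⟨ ∑-mono-≤ perPart ⟩
      ∑[ j < p ] (a * hiddenColors j + visibleIn j)                      ≡⟨ ∑-distrib-+ (λ j → a * hiddenColors j) visibleIn ⟩
      ∑[ j < p ] (a * hiddenColors j) + ∑[ j < p ] visibleIn j           ≤⟨ +-mono-≤ (≤-reflexive (sym (*-distribˡ-sum a hiddenColors))) (∑visibleIn≤ small) ⟩
      a * ∑[ j < p ] hiddenColors j + a * count visibleColor?
        ≡⟨ trans (*-distribˡ-+ a (count visibleColor?) (∑[ j < p ] hiddenColors j)) (+-comm (a * count visibleColor?) _) ⟨
      a * (count visibleColor? + ∑[ j < p ] hiddenColors j)              ≤⟨ *-monoʳ-≤ a colors-placed ⟩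
      a * suc p                                                          ∎)
      where
      open ≤-Reasoning
      perPart : ∀ j → a + 𝟙 (part y ≟ j) * suc a ≤ a * hiddenColors j + visibleIn j
      perPart j with part y ≟ j
      ... | yes refl = ≤-trans (≤-reflexive (cong (a +_) (+-identityʳ (suc a)))) (split-part-lower y-hidden u-hidden u∼y χy≢χu)
      ... | no _ = ≤-trans (≤-reflexive (+-identityʳ a)) (part-lower j (large j))
      total : ∑[ j < p ] (a + 𝟙 (part y ≟ j) * suc a) ≡ suc (a * suc p)
      total = begin-equality
        ∑[ j < p ] (a + 𝟙 (part y ≟ j) * suc a)               ≡⟨ ∑-distrib-+ (λ _ → a) (λ j → 𝟙 (part y ≟ j) * suc a) ⟩
        ∑[ j < p ] a + ∑[ j < p ] (𝟙 (part y ≟ j) * suc a)    ≡⟨ cong₂ _+_ (∑-const p a) (∑-δ (part y) (λ _ → suc a)) ⟩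
        p * a + suc a                                          ≡⟨ solve (p ∷ a ∷ []) ⟩
        suc (a * suc p)                                        ∎

  hidden-split⇒large-visible : ∀ {χ y u} → ¬ Visible χ y → ¬ Visible χ u → part u ≡ part y → ¬ χ y ≡ χ u →
                               ∃ λ x → Visible χ x × nonCenters (part y) < classSize χ (χ x)
  hidden-split⇒large-visible {χ} {y} y-hidden u-hidden u∼y χy≢χu
    with any? (λ x → visible? χ x ×-dec (nonCenters (part y) <? classSize χ (χ x)))
  ... | yes large = large
  ... | no none = ⊥-elim (hidden-split-impossible χ small large y-hidden u-hidden u∼y χy≢χu)
    where
    small : ∀ x → Visible χ x → classSize χ (χ x) ≤ nonCenters (part y)
    small x vis = ≮⇒≥ (λ large → none (x , vis , large))
    large : ∀ j → nonCenters (part y) ≤ partSize j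
    large j with has-center y
    ... | z , z∼y , z-center = ≤-pred (begin
      suc (nonCenters (part y)) ≤⟨ subst (λ i → nonCenters i < partSize i) z∼y (nonCenters<partSize z-center) ⟩
      partSize (part y)         ≤⟨ balanced (part y) j ⟩
      partSize j + 1            ≡⟨ +-comm (partSize j) 1 ⟩
      suc (partSize j)          ∎)
      where open ≤-Reasoning

  SameClass : (χ χ′ : Coloring n (suc p)) → Fin n → Set
  SameClass χ χ′ y = ∀ u → (χ y ≡ χ u → χ′ y ≡ χ′ u) × (χ′ y ≡ χ′ u → χ y ≡ χ u)

  sameClass? : ∀ χ χ′ → Decidable (SameClass χ χ′)
  sameClass? χ χ′ y = all? (λ u → ((χ y ≟ χ u) →-dec (χ′ y ≟ χ′ u)) ×-dec ((χ′ y ≟ χ′ u) →-dec (χ y ≟ χ u)))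

  classSize-sameClass : SameClass χ χ′ y → classSize χ (χ y) ≡ classSize χ′ (χ′ y)
  classSize-sameClass {χ} {χ′} {y} same = begin
    classSize χ (χ y)          ≡⟨ classSize≡count χ (χ y) ⟩
    count (λ u → χ u ≟ χ y)    ≡⟨ sum-cong-≗ (λ u → 𝟙-cong (χ u ≟ χ y) (χ′ u ≟ χ′ y)
                                    (λ eq → sym (proj₁ (same u) (sym eq))) (λ eq → sym (proj₂ (same u) (sym eq)))) ⟩
    count (λ u → χ′ u ≟ χ′ y)  ≡⟨ classSize≡count χ′ (χ′ y) ⟨
    classSize χ′ (χ′ y)        ∎
    where open ≡-Reasoning

  module _ {χ χ′ : Coloring n (suc p)} (agree : Agree χ χ′) (agree′ : Agree χ′ χ) where

    visible⇒sameClass : Visible χ y → SameClass χ χ′ y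
    visible⇒sameClass vis u = visible-class-agree agree vis , visible-class-agree agree′ (visible-agree agree vis)

    unstable⇒hidden : ¬ SameClass χ χ′ y → ¬ Visible χ y
    unstable⇒hidden unstable vis = unstable (visible⇒sameClass vis)

    unstable⇒hidden′ : ¬ SameClass χ χ′ y → ¬ Visible χ′ y
    unstable⇒hidden′ unstable vis = unstable⇒hidden unstable (visible-agree agree′ vis)

    unstable⇒large-visible : ¬ SameClass χ χ′ y → ∃ λ x → Visible χ x × nonCenters (part y) < classSize χ (χ x)
    unstable⇒large-visible {y} unstable
      with ¬∀⟶∃¬ n _ (λ u → ((χ y ≟ χ u) →-dec (χ′ y ≟ χ′ u)) ×-dec ((χ′ y ≟ χ′ u) →-dec (χ y ≟ χ u))) unstable
    ... | u , broken with χ y ≟ χ u | χ′ y ≟ χ′ u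
    ...   | yes χy≡χu | yes χ′y≡χ′u = contradiction ((λ _ → χ′y≡χ′u) , (λ _ → χy≡χu)) broken
    ...   | no χy≢χu | no χ′y≢χ′u = contradiction ((λ eq → contradiction eq χy≢χu) , (λ eq → contradiction eq χ′y≢χ′u)) broken
    ...   | no χy≢χu | yes χ′y≡χ′u =
      hidden-split⇒large-visible (unstable⇒hidden unstable)
        (λ vis → unstable⇒hidden′ unstable (visible-closed (visible-agree agree vis) (sym χ′y≡χ′u)))
        (proj₁ (hidden-class (unstable⇒hidden′ unstable) (sym χ′y≡χ′u))) χy≢χu
    ...   | yes χy≡χu | no χ′y≢χ′u =
      let x , vis′ , large = hidden-split⇒large-visible {χ′} (unstable⇒hidden′ unstable)
                               (λ vis → unstable⇒hidden unstable (visible-closed (visible-agree agree′ vis) (sym χy≡χu)))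
                               (proj₁ (hidden-class (unstable⇒hidden unstable) (sym χy≡χu))) χ′y≢χ′u
          vis = visible-agree agree′ vis′
      in x , vis , subst (nonCenters (part y) <_) (sym (classSize-sameClass (visible⇒sameClass vis))) large

    plurality-transfer : ∀ {b} → PluralityBall χ b → PluralityBall χ′ b
    plurality-transfer {b} plural k′ k′≢χ′b = subst (classSize χ′ k′ <_) (classSize-sameClass b-stable) smaller
      where
      open ≤-Reasoning
      S : ℕ
      S = classSize χ (χ b)

      largest : ∀ x → classSize χ (χ x) ≤ S
      largest x with χ x ≟ χ b
      ... | yes χx≡χb = ≤-reflexive (cong (classSize χ) χx≡χb)
      ... | no χx≢χb = <⇒≤ (plural (χ x) χx≢χb)

      b-stable : SameClass χ χ′ b
      b-stable = decidable-stable (sameClass? χ χ′ b) λ unstable →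
        let x , vis , large = unstable⇒large-visible unstable
            b-hidden = unstable⇒hidden unstable
        in <-irrefl refl (begin-strict
             classSize χ (χ x)    <⟨ plural (χ x) (λ χx≡χb → b-hidden (visible-closed vis χx≡χb)) ⟩
             S                    ≤⟨ classSize-hidden b-hidden ⟩
             nonCenters (part b)  <⟨ large ⟩
             classSize χ (χ x)    ∎)

      smaller : classSize χ′ k′ < S
      smaller with any? (λ y → χ′ y ≟ k′)
      ... | no unused = subst (_< S) (sym (empty-class χ′ (λ y eq → unused (y , eq)))) (own-class-nonempty χ b)
      ... | yes (y , refl) with sameClass? χ χ′ y
      ...   | yes y-stable = subst (_< S) (classSize-sameClass y-stable) (plural (χ y) χy≢χb)
        where
        χy≢χb : ¬ χ y ≡ χ b
        χy≢χb eq = k′≢χ′b (sym (proj₁ (b-stable y) (sym eq)))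
      ...   | no unstable = begin-strict
        classSize χ′ (χ′ y)  ≤⟨ classSize-hidden (unstable⇒hidden′ unstable) ⟩
        nonCenters (part y)  <⟨ proj₂ (proj₂ (unstable⇒large-visible unstable)) ⟩
        classSize χ (χ _)    ≤⟨ largest _ ⟩
        S                    ∎

module ResidueQueries (n p : ℕ) .{{_ : NonZero p}} where

  part : Fin n → Fin p
  part x = toℕ x mod p

  IsCenter : Pred (Fin n) 0ℓ
  IsCenter x = toℕ x < p

  has-center : ∀ x → ∃ λ z → part z ≡ part x × IsCenter z
  has-center x = z , toℕ-injective part-z , subst (_< p) (sym toℕ-z) (m%n<n (toℕ x) p)
    where
    z : Fin n
    z = fromℕ< (≤-<-trans (m%n≤m (toℕ x) p) (toℕ<n x))
    toℕ-z : toℕ z ≡ toℕ x % p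
    toℕ-z = toℕ-fromℕ< _
    part-z : toℕ (part z) ≡ toℕ (part x)
    part-z = begin
      toℕ (toℕ z mod p)   ≡⟨ toℕ-mod p (toℕ z) ⟩
      toℕ z % p           ≡⟨ cong (_% p) toℕ-z ⟩
      toℕ x % p % p       ≡⟨ m%n%n≡m%n (toℕ x) p ⟩
      toℕ x % p           ≡⟨ toℕ-mod p (toℕ x) ⟨
      toℕ (toℕ x mod p)   ∎
      where open ≡-Reasoning

  partSize≡ : ∀ i → count (λ x → part x ≟ i) ≡ n / p + 𝟙 (toℕ i <? n % p)
  partSize≡ i = count-mod′ p n i

  balanced : ∀ i j → count (λ x → part x ≟ i) ≤ count (λ x → part x ≟ j) + 1
  balanced i j = begin
    count (λ x → part x ≟ i)  ≡⟨ partSize≡ i ⟩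
    n / p + 𝟙 (toℕ i <? n % p) ≤⟨ +-monoʳ-≤ (n / p) (𝟙≤1 (toℕ i <? n % p)) ⟩
    n / p + 1                  ≤⟨ +-monoˡ-≤ 1 (m≤m+n (n / p) _) ⟩
    n / p + 𝟙 (toℕ j <? n % p) + 1 ≡⟨ cong (_+ 1) (partSize≡ j) ⟨
    count (λ x → part x ≟ j) + 1 ∎
    where open ≤-Reasoning

  open CenteredPartition part (λ x → toℕ x <? p) has-center balanced public

  Ascending : Fin n → Fin n → Set
  Ascending x y = toℕ x < toℕ y × Compared x y

  ascending? : ∀ x y → Dec (Ascending x y)
  ascending? x y = (toℕ x <? toℕ y) ×-dec compared? x y

  queriesTo : Fin n → List (Query n)
  queriesTo y = map (_, y) (filter (λ x → ascending? x y) (allFin n))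

  queries : List (Query n)
  queries = concatMap queriesTo (allFin n)

  ∈-queries : ∀ {x y} → Ascending x y → (x , y) ∈ queries
  ∈-queries {x} {y} asc = ∈-concatMap⁺ queriesTo (lose (∈-allFin y) (∈-map⁺ (_, y) (∈-filter⁺ (λ x → ascending? x y) (∈-allFin x) asc)))

  compared-sym : ∀ {x y} → Compared x y → Compared y x
  compared-sym (inj₁ x≁y) = inj₁ (λ eq → x≁y (sym eq))
  compared-sym (inj₂ (inj₁ x-center)) = inj₂ (inj₂ x-center)
  compared-sym (inj₂ (inj₂ y-center)) = inj₂ (inj₁ y-center)

  same-answers⇒agree : {χ χ′ : Coloring n (suc p)} → answers χ queries ≡ answers χ′ queries → Agree χ χ′
  same-answers⇒agree {χ} {χ′} same {x} {y} compared χx≡χy with <-cmp (toℕ x) (toℕ y)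
  ... | tri< x<y _ _ = does-≡⇒ (χ x ≟ χ y) (χ′ x ≟ χ′ y) (map-≡⇒∈ same (∈-queries (x<y , compared))) χx≡χy
  ... | tri≈ _ x≡y _ = cong χ′ (toℕ-injective x≡y)
  ... | tri> _ _ y<x = sym (does-≡⇒ (χ y ≟ χ x) (χ′ y ≟ χ′ x) (map-≡⇒∈ same (∈-queries (y<x , compared-sym compared))) (sym χx≡χy))

  queries-solve : Solves n (suc p) queries
  queries-solve = answers-determine-plurality⇒Solves queries
    (λ same b → plurality-transfer (same-answers⇒agree same) (same-answers⇒agree (sym same)))

  length-queries : length queries ≡ ∑[ y < n ] count (λ x → ascending? x y)
  length-queries = trans (length-concatMap-tabulate (λ i → i) queriesTo)
    (sum-cong-≗ {n} (λ y → trans (length-map (_, y) (filter (λ x → ascending? x y) (allFin n)))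
                                 (length-filter-tabulate (λ x → ascending? x y) (λ i → i))))

  centers-unique : ∀ {x x′} → IsCenter x → IsCenter x′ → part x ≡ part x′ → x ≡ x′
  centers-unique {x} {x′} x<p x′<p same-part = toℕ-injective (begin
    toℕ x               ≡⟨ m<n⇒m%n≡m x<p ⟨
    toℕ x % p           ≡⟨ toℕ-mod p (toℕ x) ⟨
    toℕ (part x)        ≡⟨ cong toℕ same-part ⟩
    toℕ (part x′)       ≡⟨ toℕ-mod p (toℕ x′) ⟩
    toℕ x′ % p          ≡⟨ m<n⇒m%n≡m x′<p ⟩
    toℕ x′              ∎)
    where open ≡-Reasoning

  -- Of the toℕ y balls below y, ⌊y/p⌋ lie in the part of y and at most one of those, its
  -- center, is compared with y.
  ascending+y/p≤ : ∀ y → count (λ x → ascending? x y) + toℕ y / p ≤ suc (toℕ y)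
  ascending+y/p≤ y = begin
    count (λ x → ascending? x y) + m / p                       ≤⟨ +-monoʳ-≤ (count (λ x → ascending? x y)) same-part-below ⟩
    count (λ x → ascending? x y) + (count uncompared-below + 1) ≡⟨ +-assoc (count (λ x → ascending? x y)) (count uncompared-below) 1 ⟨
    count (λ x → ascending? x y) + count uncompared-below + 1   ≡⟨ cong (_+ 1) below-split ⟩
    m + 1                                                      ≡⟨ +-comm m 1 ⟩
    suc m                                                      ∎
    where
    open ≤-Reasoning
    m : ℕ
    m = toℕ y
    m≤n : m ≤ n
    m≤n = <⇒≤ (toℕ<n y)

    uncompared-below : ∀ x → Dec (toℕ x < m × ¬ Compared x y)
    uncompared-below x = (toℕ x <? m) ×-dec ¬? (compared? x y)

    center-of-part : ∀ x → Dec (IsCenter x × part x ≡ part y)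
    center-of-part x = (toℕ x <? p) ×-dec (part x ≟ part y)

    below-split : count (λ x → ascending? x y) + count uncompared-below ≡ m
    below-split = begin-equality
      count (λ x → ascending? x y) + count uncompared-below       ≡⟨ ∑-distrib-+ (λ x → 𝟙 (ascending? x y)) (λ x → 𝟙 (uncompared-below x)) ⟨
      ∑[ x < n ] (𝟙 (ascending? x y) + 𝟙 (uncompared-below x))    ≡⟨ sum-cong-≗ {n} (λ x → 𝟙-split (toℕ x <? m) (compared? x y)) ⟩
      count (λ (x : Fin n) → toℕ x <? m)                                 ≡⟨ count-below {n} m≤n ⟩
      m                                                          ∎

    same-part-below : m / p ≤ count uncompared-below + 1
    same-part-below = begin
      m / p                                                      ≡⟨ +-identityʳ (m / p) ⟨
      m / p + 0                                                  ≡⟨ cong (m / p +_) (𝟙-no (toℕ (part y) <? m % p) (λ lt → <-irrefl (toℕ-mod p m) lt)) ⟨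
      m / p + 𝟙 (toℕ (part y) <? m % p)                          ≡⟨ trans (∑-below (λ s → 𝟙 (s mod p ≟ part y)) m≤n) (count-mod′ p m (part y)) ⟨
      ∑[ x < n ] (𝟙 (toℕ x <? m) * 𝟙 (part x ≟ part y))          ≤⟨ ∑-mono-≤ same-part ⟩
      ∑[ x < n ] (𝟙 (uncompared-below x) + 𝟙 (center-of-part x)) ≡⟨ ∑-distrib-+ (λ x → 𝟙 (uncompared-below x)) (λ x → 𝟙 (center-of-part x)) ⟩
      count uncompared-below + count center-of-part              ≤⟨ +-monoʳ-≤ (count uncompared-below)
                                                                      (count≤1 center-of-part (λ (x-center , x∈y) (x′-center , x′∈y) →
                                                                         centers-unique x-center x′-center (trans x∈y (sym x′∈y)))) ⟩
      count uncompared-below + 1                                 ∎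
      where
      same-part : ∀ x → 𝟙 (toℕ x <? m) * 𝟙 (part x ≟ part y) ≤ 𝟙 (uncompared-below x) + 𝟙 (center-of-part x)
      same-part x = cases (toℕ x <? m) (part x ≟ part y) (compared? x y)
        where
        cases : (below : Dec (toℕ x < m)) (x∈y? : Dec (part x ≡ part y)) (compared : Dec (Compared x y)) →
                𝟙 below * 𝟙 x∈y? ≤ 𝟙 (below ×-dec ¬? compared) + 𝟙 ((toℕ x <? p) ×-dec x∈y?)
        cases (no _) _ _ = z≤n
        cases (yes _) (no _) _ = z≤n
        cases (yes _) (yes _) (no _) = s≤s z≤n
        cases (yes _) (yes x∈y) (yes (inj₁ x≁y)) = contradiction x∈y x≁y
        cases (yes _) (yes x∈y) (yes (inj₂ (inj₁ x-center))) = ≤-reflexive (sym (𝟙-yes ((toℕ x <? p) ×-dec yes x∈y) (x-center , x∈y)))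
        cases (yes x<m) (yes x∈y) (yes (inj₂ (inj₂ y-center))) =
          ≤-reflexive (sym (𝟙-yes ((toℕ x <? p) ×-dec yes x∈y) (<-trans x<m y-center , x∈y)))

  length-queries+floorSum≤ : length queries + floorSum p n ≤ ∑[ y < n ] suc (toℕ y)
  length-queries+floorSum≤ = begin
    length queries + floorSum p n                                          ≡⟨ cong (_+ floorSum p n) length-queries ⟩
    ∑[ y < n ] count (λ x → ascending? x y) + ∑[ y < n ] (toℕ y / p)        ≡⟨ ∑-distrib-+ (λ y → count (λ x → ascending? x y)) (λ y → toℕ y / p) ⟨
    ∑[ y < n ] (count (λ x → ascending? x y) + toℕ y / p)                  ≤⟨ ∑-mono-≤ ascending+y/p≤ ⟩
    ∑[ y < n ] suc (toℕ y)                                                 ∎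
    where open ≤-Reasoning

  length-queries≤ : 2 * p * length queries ≤ (p ∸ 1) * (n * n) + 2 * p * n
  length-queries≤ = +-cancelʳ-≤ (n * n) _ _ (begin
    2 * p * L + n * n                              ≤⟨ +-monoʳ-≤ (2 * p * L) (square≤floorSum p n) ⟩
    2 * p * L + (p * n + 2 * p * F)                ≡⟨ regroup L F ⟩
    p * (2 * (L + F)) + p * n                      ≤⟨ +-monoˡ-≤ (p * n) (*-monoʳ-≤ p (*-monoʳ-≤ 2 length-queries+floorSum≤)) ⟩
    p * (2 * ∑[ y < n ] suc (toℕ y)) + p * n       ≡⟨ cong (λ s → p * s + p * n) (triangular n) ⟩
    p * (n * suc n) + p * n                        ≡⟨ expand p ⟩
    p * (n * n) + 2 * p * n                        ≡⟨ cong (λ s → s * (n * n) + 2 * p * n) (m∸n+n≡m {p} {1} (>-nonZero⁻¹ p)) ⟨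
    (p ∸ 1 + 1) * (n * n) + 2 * p * n              ≡⟨ shift (p ∸ 1) ⟩
    (p ∸ 1) * (n * n) + 2 * p * n + n * n          ∎)
    where
    open ≤-Reasoning
    L F : ℕ
    L = length queries
    F = floorSum p n
    regroup : ∀ L F → 2 * p * L + (p * n + 2 * p * F) ≡ p * (2 * (L + F)) + p * n
    regroup L F = solve (p ∷ n ∷ L ∷ F ∷ [])
    expand : ∀ p → p * (n * suc n) + p * n ≡ p * (n * n) + 2 * p * n
    expand p = solve (n ∷ p ∷ [])
    shift : ∀ q → (q + 1) * (n * n) + 2 * p * n ≡ q * (n * n) + 2 * p * n + n * n
    shift q = solve (q ∷ n ∷ p ∷ [])

theorem2 : ∀ (n c : ℕ) → 1 ≤ n → 3 ≤ c →
    (∀ (Q : List (Query n)) → Solves n c Q →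
        (n ∸ 1) * (c ∸ 2) * n ≤ 2 * (c ∸ 1) * length Q)
    × (∃ λ (Q : List (Query n)) → Solves n c Q ×
        (2 * (c ∸ 1) * length Q ≤ (c ∸ 2) * (n * n) + 2 * (c ∸ 1) * n))
theorem2 zero _ () _
theorem2 (suc L) zero _ ()
theorem2 (suc L) (suc zero) _ (s≤s ())
theorem2 (suc L) (suc (suc zero)) _ (s≤s (s≤s ()))
theorem2 (suc L) (suc (suc (suc k-1))) _ _ = lower-bound k-1 , (queries , queries-solve , length-queries≤)
  where open ResidueQueries (suc L) (suc (suc k-1))
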